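{- Let $k\ge 1$ and $n=p_1\cdots p_k$ with $p_1<\cdots<p_k$ odd primes. Then $g(\Psi_n)\ge\delta^-(n)$, where $\delta^-(n)=2\,\frac{n}{p_1}-\psi(n)$.
   Context: $\Psi_n(x)=\prod_{1\le j\le n,\ \gcd(j,n)\ne1}(x-e^{2\pi i j/n})$ is the $n$-th inverse cyclotomic polynomial. For a polynomial $f=c_1x^{\nu_1}+\cdots+c_tx^{\nu_t}$ with all $c_i\ne0$ and $0\le\nu_1<\cdots<\nu_t$, the maximum gap is $g(f)=\max_{1\le i<t}(\nu_{i+1}-\nu_i)$ if $t\ne1$, and $g(f)=0$ if $t=1$. $\psi(n)=\deg\Psi_n=n-\varphi(n)$, where $\varphi$ is Euler's totient. -}

module Defs where

open import Data.Nat as ℕ using (ℕ; zero; suc; _≤?_)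
open import Data.Nat.GCD using (gcd)
open import Data.Nat.Divisibility using (_∣?_)
open import Data.Integer as ℤ using (ℤ; +_; -_)
open import Data.List using (List; []; _∷_; length; filter; map; reverse; foldr; replicate; _++_)
open import Data.Product using (_×_; _,_)
open import Relation.Nullary.Decidable using (does; ¬?)
open import Data.Bool using (if_then_else_)

-- Integer polynomials as coefficient lists, lowest degree first.
-- (Trailing zeros are allowed; they do not affect the support.)

Poly : Set
Poly = List ℤ

_⊕_ : Poly → Poly → Poly
[] ⊕ q = q
(a ∷ p) ⊕ [] = a ∷ p
(a ∷ p) ⊕ (b ∷ q) = (a ℤ.+ b) ∷ (p ⊕ q)

_⊗_ : Poly → Poly → Poly
[] ⊗ q = []
(a ∷ p) ⊗ q = map (a ℤ.*_) q ⊕ (+ 0 ∷ (p ⊗ q))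

one : Poly
one = + 1 ∷ []

xPowMinusOne : ℕ → Poly
xPowMinusOne zero = []
xPowMinusOne (suc d) = - (+ 1) ∷ (replicate d (+ 0) ++ (+ 1 ∷ []))

normalize : Poly → Poly
normalize p = reverse (dropZ (reverse p))
  where
  dropZ : List ℤ → List ℤ
  dropZ [] = []
  dropZ (+ zero ∷ xs) = dropZ xs
  dropZ (x ∷ xs) = x ∷ xs

-- Long division by a monic polynomial, on coefficient lists written
-- highest degree first.  The divisor is given without its leading 1.
private
  subFront : List ℤ → List ℤ → List ℤ
  subFront xs [] = xs
  subFront [] (y ∷ ys) = []
  subFront (x ∷ xs) (y ∷ ys) = (x ℤ.- y) ∷ subFront xs ys

  divHF : ℕ → List ℤ → List ℤ → List ℤ
  divHF zero as bs = []
  divHF (suc f) [] bs = []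
  divHF (suc f) (c ∷ as) bs =
    if does (length bs ≤? length as)
    then c ∷ divHF f (subFront as (map (c ℤ.*_) bs)) bs
    else []

-- quotient of a by the monic polynomial b (both lowest degree first);
-- used only for exact divisions below.
monicQuot : Poly → Poly → Poly
monicQuot a b with reverse (normalize b)
... | [] = []
... | _ ∷ bs = reverse (divHF (length a) (reverse (normalize a)) bs)

-- Cyclotomic / inverse cyclotomic polynomials.
-- Φ_d = (x^d - 1) / Ψ_d  and  Ψ_n = ∏_{d ∣ n, d < n} Φ_d.
-- Recursion with fuel (fuel ≥ n suffices, since all proper divisors d < n).

properDivisors : ℕ → List ℕ
properDivisors n = filter (λ d → d ∣? n) (Data.List.upTo n) where import Data.List

-- note: upTo n = 0 ∷ … ∷ n-1 ; 0 ∣ n is false for n ≥ 1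

PsiAux : ℕ → ℕ → Poly
PsiAux zero n = one
PsiAux (suc f) n =
  foldr (λ d acc → normalize (monicQuot (xPowMinusOne d) (PsiAux f d) ⊗ acc))
        one (properDivisors n)

Psi : ℕ → Poly
Psi n = normalize (PsiAux n n)

supportFrom : ℕ → Poly → List ℕ
supportFrom i [] = []
supportFrom i (+ zero ∷ p) = supportFrom (suc i) p
supportFrom i (c ∷ p) = i ∷ supportFrom (suc i) p

support : Poly → List ℕ
support = supportFrom 0

maxGapList : List ℕ → ℕ
maxGapList [] = 0
maxGapList (a ∷ []) = 0
maxGapList (a ∷ b ∷ rest) = (b ℕ.∸ a) ℕ.⊔ maxGapList (b ∷ rest)

maxGap : Poly → ℕ
maxGap f = maxGapList (support f)

totient : ℕ → ℕ
totient n = length (filter (λ j → gcd j n ℕ.≟ 1) (map suc (Data.List.upTo n)))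
  where import Data.List

psi : ℕ → ℕ
psi n = n ℕ.∸ totient n

deltaMinus : (n p₁ : ℕ) .{{_ : ℕ.NonZero p₁}} → ℤ
deltaMinus n p₁ = (+ (2 ℕ.* (n ℕ./ p₁))) ℤ.- (+ psi n)

{-# OPTIONS --safe #-}
-- Let m be a proper divisor of n. Then x^m − 1 = ∏_{d ∣ m} Φ_d divides Ψ_n = ∏_{d ∣ n, d < n} Φ_d, which is
-- monic of degree ψ(n), so Ψ_n = (x^m − 1) F = x^m F − F with F monic of degree ψ(n) − m. If ψ(n) − m < m,
-- the terms of −F (degrees ≤ ψ(n) − m, the top one being −1) and of x^m F (degrees ≥ m) do not interact,
-- so Ψ_n has no terms strictly between ψ(n) − m and m, and g(Ψ_n) ≥ 2m − ψ(n); otherwise the bound is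
-- negative. The theorem is the case m = n / p₁.
--
-- Both facts about Ψ_n rest on the exactness of the division of x^d − 1 by Ψ_d that defines Φ_d, proved by
-- strong induction on d: the Φ_e with e a proper divisor of d are monic of degree φ(e), pairwise coprime over ℚ
-- (Φ_a is coprime to x^g − 1 for each proper divisor g of a, and g = gcd(a, b) is a proper divisor of a or
-- of b), and each divides x^d − 1; hence so does their product, whose degree ∑ φ(e) = d − φ(d) is given by
-- Gauss's formula.
module Submission where

module InverseCyclotomic where
  open import Defs
  open import Algebra.Bundles using (CommutativeRing)
  open import Data.Integer as ℤ using (ℤ; +_; -[1+_])
  import Data.Integer.Properties as ℤP
  open import Data.List using (List; []; _∷_; _++_; filter; foldr; length; map; replicate; reverse; upTo)
  open import Data.List.Relation.Unary.All as All using (All; []; _∷_)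
  import Data.List.Relation.Unary.All.Properties as All
  open import Data.List.Relation.Unary.AllPairs using (AllPairs; []; _∷_)
  open import Data.List.Relation.Unary.Any as Any using (Any; here; there)
  open import Data.List.Membership.Propositional using (_∈_)
  import Data.List.Properties as List
  open import Data.Maybe as Maybe using (Maybe; just; nothing)
  open import Data.Bool using (if_then_else_)
  open import Data.Empty using (⊥-elim)
  open import Data.Nat.Induction using (<-rec)
  open import Data.Nat.DivMod using (_/_; 0/n≡0; m*n/n≡m)
  open import Data.Nat.Divisibility using (_∣_; _∣?_; divides; _∣0; ∣-refl; ∣-trans; ∣⇒≤; ∣m∣n⇒∣m+n; ∣m+n∣m⇒∣n)
  open import Data.Nat.GCD using (gcd; gcd[m,n]∣m; gcd[m,n]∣n; gcd[m,n]≡0⇒m≡0; c*gcd[m,n]≡gcd[cm,cn])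
  open import Data.Nat as ℕ using (ℕ; NonZero; zero; suc; _+_; _*_; _∸_; _≤_; _<_; _≤?_; _<?_; z≤n; s≤s)
  import Data.Nat.Properties as ℕP
  open import Data.Sum using (_⊎_; inj₁; inj₂)
  open import Function using (id; _∘_)
  open import Relation.Nullary using (¬_; Dec; yes; no; does)
  open import Relation.Nullary.Decidable using (dec-true; dec-false)
  open import Relation.Unary using (Decidable)
  open import Data.Product using (Σ; _×_; _,_; proj₁; proj₂)
  open import Level using (0ℓ)
  open import Relation.Binary.PropositionalEquality
    using (_≡_; refl; sym; trans; cong; cong₂; subst; module ≡-Reasoning)
  import Relation.Binary.Reasoning.Setoid
  import Tactic.RingSolver.Core.AlmostCommutativeRing as ACR
  open import Tactic.RingSolver using (solve-∀)
  open import Data.Integer.Tactic.RingSolver using () renaming (solve-∀ to solve-∀ℤ)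
  open import Data.Nat.Tactic.RingSolver using () renaming (solve-∀ to solve-∀ℕ)

  -- Polynomials up to trailing zeros

  coeff : Poly → ℕ → ℤ
  coeff [] i = + 0
  coeff (a ∷ p) zero = a
  coeff (a ∷ p) (suc i) = coeff p i

  infix 4 _≈_
  record _≈_ (p q : Poly) : Set where
    constructor mk≈
    field
      at : ∀ i → coeff p i ≡ coeff q i
  open _≈_ public

  ≈-refl : ∀ {p} → p ≈ p
  ≈-refl = mk≈ λ _ → refl

  ≈-sym : ∀ {p q} → p ≈ q → q ≈ p
  ≈-sym p≈q = mk≈ λ i → sym (at p≈q i)

  ≈-trans : ∀ {p q r} → p ≈ q → q ≈ r → p ≈ r
  ≈-trans p≈q q≈r = mk≈ λ i → trans (at p≈q i) (at q≈r i)

  ≡⇒≈ : ∀ {p q} → p ≡ q → p ≈ q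
  ≡⇒≈ refl = ≈-refl

  scale : ℤ → Poly → Poly
  scale c = map (c ℤ.*_)

  neg : Poly → Poly
  neg = map λ a → ℤ.- a

  shift : Poly → Poly
  shift p = + 0 ∷ p

  [_]ₚ : ℤ → Poly
  [ c ]ₚ = c ∷ []

  coeff-⊕ : ∀ p q i → coeff (p ⊕ q) i ≡ coeff p i ℤ.+ coeff q i
  coeff-⊕ [] q i = sym (ℤP.+-identityˡ _)
  coeff-⊕ (a ∷ p) [] i = sym (ℤP.+-identityʳ _)
  coeff-⊕ (a ∷ p) (b ∷ q) zero = refl
  coeff-⊕ (a ∷ p) (b ∷ q) (suc i) = coeff-⊕ p q i

  coeff-scale : ∀ c p i → coeff (scale c p) i ≡ c ℤ.* coeff p i
  coeff-scale c [] i = sym (ℤP.*-zeroʳ c)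
  coeff-scale c (a ∷ p) zero = refl
  coeff-scale c (a ∷ p) (suc i) = coeff-scale c p i

  coeff-neg : ∀ p i → coeff (neg p) i ≡ ℤ.- coeff p i
  coeff-neg [] i = refl
  coeff-neg (a ∷ p) zero = refl
  coeff-neg (a ∷ p) (suc i) = coeff-neg p i

  coeff-shift-[] : ∀ i → coeff (shift []) i ≡ + 0
  coeff-shift-[] zero = refl
  coeff-shift-[] (suc i) = refl

  coeff-∷⊗ : ∀ a p q i → coeff ((a ∷ p) ⊗ q) i ≡ a ℤ.* coeff q i ℤ.+ coeff (shift (p ⊗ q)) i
  coeff-∷⊗ a p q i = trans (coeff-⊕ (scale a q) (shift (p ⊗ q)) i) (cong (ℤ._+ _) (coeff-scale a q i))

  ∷-cong : ∀ {a b p q} → a ≡ b → p ≈ q → a ∷ p ≈ b ∷ q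
  ∷-cong {a} {b} {p} {q} a≡b p≈q = mk≈ coeffs
    where
    coeffs : ∀ i → coeff (a ∷ p) i ≡ coeff (b ∷ q) i
    coeffs zero = a≡b
    coeffs (suc i) = at p≈q i

  shift-cong : ∀ {p q} → p ≈ q → shift p ≈ shift q
  shift-cong = ∷-cong refl

  shift-[] : shift [] ≈ []
  shift-[] = mk≈ coeff-shift-[]

  tail-≈[] : ∀ {a p} → a ∷ p ≈ [] → p ≈ []
  tail-≈[] a∷p≈0 = mk≈ λ i → at a∷p≈0 (suc i)

  ⊕-cong : ∀ {p p′ q q′} → p ≈ p′ → q ≈ q′ → p ⊕ q ≈ p′ ⊕ q′
  ⊕-cong {p} {p′} {q} {q′} p≈p′ q≈q′ = mk≈ λ i → begin
    coeff (p ⊕ q) i              ≡⟨ coeff-⊕ p q i ⟩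
    coeff p i ℤ.+ coeff q i      ≡⟨ cong₂ ℤ._+_ (at p≈p′ i) (at q≈q′ i) ⟩
    coeff p′ i ℤ.+ coeff q′ i    ≡⟨ coeff-⊕ p′ q′ i ⟨
    coeff (p′ ⊕ q′) i            ∎
    where open ≡-Reasoning

  scale-cong : ∀ c {p q} → p ≈ q → scale c p ≈ scale c q
  scale-cong c {p} {q} p≈q = mk≈ λ i →
    trans (coeff-scale c p i) (trans (cong (c ℤ.*_) (at p≈q i)) (sym (coeff-scale c q i)))

  neg-cong : ∀ {p q} → p ≈ q → neg p ≈ neg q
  neg-cong {p} {q} p≈q = mk≈ λ i →
    trans (coeff-neg p i) (trans (cong ℤ.-_ (at p≈q i)) (sym (coeff-neg q i)))

  ⊗-zeroˡ : ∀ p q → p ≈ [] → p ⊗ q ≈ []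
  ⊗-zeroˡ [] q p≈0 = ≈-refl
  ⊗-zeroˡ (a ∷ p) q p≈0 = mk≈ λ i → begin
    coeff ((a ∷ p) ⊗ q) i                           ≡⟨ coeff-∷⊗ a p q i ⟩
    a ℤ.* coeff q i ℤ.+ coeff (shift (p ⊗ q)) i      ≡⟨ cong₂ ℤ._+_ (cong (ℤ._* coeff q i) (at p≈0 zero))
                                                          (at (shift-cong (⊗-zeroˡ p q (tail-≈[] p≈0))) i) ⟩
    + 0 ℤ.* coeff q i ℤ.+ coeff (shift []) i         ≡⟨ trans (ℤP.+-identityˡ _) (coeff-shift-[] i) ⟩
    + 0                                              ∎
    where open ≡-Reasoning

  ⊗-congˡ : ∀ {p p′} q → p ≈ p′ → p ⊗ q ≈ p′ ⊗ q
  ⊗-congˡ {[]} {p′} q p≈p′ = ≈-sym (⊗-zeroˡ p′ q (≈-sym p≈p′))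
  ⊗-congˡ {a ∷ p} {[]} q p≈p′ = ⊗-zeroˡ (a ∷ p) q p≈p′
  ⊗-congˡ {a ∷ p} {b ∷ p′} q p≈p′ = mk≈ λ i → begin
    coeff ((a ∷ p) ⊗ q) i                          ≡⟨ coeff-∷⊗ a p q i ⟩
    a ℤ.* coeff q i ℤ.+ coeff (shift (p ⊗ q)) i     ≡⟨ cong₂ ℤ._+_ (cong (ℤ._* coeff q i) (at p≈p′ zero))
                                                         (at (shift-cong (⊗-congˡ q (tail-≈ p≈p′))) i) ⟩
    b ℤ.* coeff q i ℤ.+ coeff (shift (p′ ⊗ q)) i    ≡⟨ coeff-∷⊗ b p′ q i ⟨
    coeff ((b ∷ p′) ⊗ q) i                         ∎
    where
    open ≡-Reasoning
    tail-≈ : ∀ {a b p q} → a ∷ p ≈ b ∷ q → p ≈ q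
    tail-≈ e = mk≈ λ i → at e (suc i)

  ⊗-congʳ : ∀ p {q q′} → q ≈ q′ → p ⊗ q ≈ p ⊗ q′
  ⊗-congʳ [] q≈q′ = ≈-refl
  ⊗-congʳ (a ∷ p) q≈q′ = ⊕-cong (scale-cong a q≈q′) (shift-cong (⊗-congʳ p q≈q′))

  ⊗-cong : ∀ {p p′ q q′} → p ≈ p′ → q ≈ q′ → p ⊗ q ≈ p′ ⊗ q′
  ⊗-cong {p′ = p′} {q} p≈p′ q≈q′ = ≈-trans (⊗-congˡ q p≈p′) (⊗-congʳ p′ q≈q′)

  ⊕-comm : ∀ p q → p ⊕ q ≈ q ⊕ p
  ⊕-comm p q = mk≈ λ i →
    trans (coeff-⊕ p q i) (trans (ℤP.+-comm (coeff p i) (coeff q i)) (sym (coeff-⊕ q p i)))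

  ⊕-assoc : ∀ p q r → (p ⊕ q) ⊕ r ≈ p ⊕ (q ⊕ r)
  ⊕-assoc p q r = mk≈ λ i → begin
    coeff ((p ⊕ q) ⊕ r) i                          ≡⟨ coeff-⊕ (p ⊕ q) r i ⟩
    coeff (p ⊕ q) i ℤ.+ coeff r i                  ≡⟨ cong (ℤ._+ coeff r i) (coeff-⊕ p q i) ⟩
    (coeff p i ℤ.+ coeff q i) ℤ.+ coeff r i        ≡⟨ ℤP.+-assoc (coeff p i) (coeff q i) (coeff r i) ⟩
    coeff p i ℤ.+ (coeff q i ℤ.+ coeff r i)        ≡⟨ cong (ℤ._+_ (coeff p i)) (coeff-⊕ q r i) ⟨
    coeff p i ℤ.+ coeff (q ⊕ r) i                  ≡⟨ coeff-⊕ p (q ⊕ r) i ⟨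
    coeff (p ⊕ (q ⊕ r)) i                          ∎
    where open ≡-Reasoning

  ⊕-identityʳ : ∀ p → p ⊕ [] ≈ p
  ⊕-identityʳ p = mk≈ λ i → trans (coeff-⊕ p [] i) (ℤP.+-identityʳ _)

  ⊕-inverseˡ : ∀ p → neg p ⊕ p ≈ []
  ⊕-inverseˡ p = mk≈ λ i →
    trans (coeff-⊕ (neg p) p i) (trans (cong (ℤ._+ coeff p i) (coeff-neg p i)) (ℤP.+-inverseˡ (coeff p i)))

  ⊕-inverseʳ : ∀ p → p ⊕ neg p ≈ []
  ⊕-inverseʳ p = ≈-trans (⊕-comm p (neg p)) (⊕-inverseˡ p)

  ⊗-distribʳ : ∀ p q r → (p ⊕ q) ⊗ r ≈ (p ⊗ r) ⊕ (q ⊗ r)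
  ⊗-distribʳ [] q r = ≈-refl
  ⊗-distribʳ (a ∷ p) [] r = ≈-sym (⊕-identityʳ ((a ∷ p) ⊗ r))
  ⊗-distribʳ (a ∷ p) (b ∷ q) r = mk≈ λ i → begin
    coeff (((a ℤ.+ b) ∷ (p ⊕ q)) ⊗ r) i
      ≡⟨ coeff-∷⊗ (a ℤ.+ b) (p ⊕ q) r i ⟩
    (a ℤ.+ b) ℤ.* coeff r i ℤ.+ coeff (shift ((p ⊕ q) ⊗ r)) i
      ≡⟨ cong (ℤ._+_ ((a ℤ.+ b) ℤ.* coeff r i)) (at (shift-cong (⊗-distribʳ p q r)) i) ⟩
    (a ℤ.+ b) ℤ.* coeff r i ℤ.+ coeff (shift (p ⊗ r) ⊕ shift (q ⊗ r)) i
      ≡⟨ cong (ℤ._+_ ((a ℤ.+ b) ℤ.* coeff r i)) (coeff-⊕ (shift (p ⊗ r)) (shift (q ⊗ r)) i) ⟩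
    (a ℤ.+ b) ℤ.* coeff r i ℤ.+ (coeff (shift (p ⊗ r)) i ℤ.+ coeff (shift (q ⊗ r)) i)
      ≡⟨ rearrange a b (coeff r i) _ _ ⟩
    (a ℤ.* coeff r i ℤ.+ coeff (shift (p ⊗ r)) i) ℤ.+ (b ℤ.* coeff r i ℤ.+ coeff (shift (q ⊗ r)) i)
      ≡⟨ cong₂ ℤ._+_ (coeff-∷⊗ a p r i) (coeff-∷⊗ b q r i) ⟨
    coeff ((a ∷ p) ⊗ r) i ℤ.+ coeff ((b ∷ q) ⊗ r) i
      ≡⟨ coeff-⊕ ((a ∷ p) ⊗ r) ((b ∷ q) ⊗ r) i ⟨
    coeff (((a ∷ p) ⊗ r) ⊕ ((b ∷ q) ⊗ r)) i
      ∎
    where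
    open ≡-Reasoning
    rearrange : ∀ a b c u v → (a ℤ.+ b) ℤ.* c ℤ.+ (u ℤ.+ v) ≡ (a ℤ.* c ℤ.+ u) ℤ.+ (b ℤ.* c ℤ.+ v)
    rearrange = solve-∀ℤ

  scale-⊗ : ∀ c p q → scale c p ⊗ q ≈ scale c (p ⊗ q)
  scale-⊗ c [] q = ≈-refl
  scale-⊗ c (a ∷ p) q = mk≈ λ i → begin
    coeff ((c ℤ.* a ∷ scale c p) ⊗ q) i
      ≡⟨ coeff-∷⊗ (c ℤ.* a) (scale c p) q i ⟩
    c ℤ.* a ℤ.* coeff q i ℤ.+ coeff (shift (scale c p ⊗ q)) i
      ≡⟨ cong (ℤ._+_ (c ℤ.* a ℤ.* coeff q i)) (at (≈-trans (shift-cong (scale-⊗ c p q)) shift-scale) i) ⟩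
    c ℤ.* a ℤ.* coeff q i ℤ.+ coeff (scale c (shift (p ⊗ q))) i
      ≡⟨ cong (ℤ._+_ (c ℤ.* a ℤ.* coeff q i)) (coeff-scale c (shift (p ⊗ q)) i) ⟩
    c ℤ.* a ℤ.* coeff q i ℤ.+ c ℤ.* coeff (shift (p ⊗ q)) i
      ≡⟨ factor c a (coeff q i) _ ⟩
    c ℤ.* (a ℤ.* coeff q i ℤ.+ coeff (shift (p ⊗ q)) i)
      ≡⟨ cong (c ℤ.*_) (coeff-∷⊗ a p q i) ⟨
    c ℤ.* coeff ((a ∷ p) ⊗ q) i
      ≡⟨ coeff-scale c ((a ∷ p) ⊗ q) i ⟨
    coeff (scale c ((a ∷ p) ⊗ q)) i
      ∎
    where
    open ≡-Reasoning
    shift-scale : shift (scale c (p ⊗ q)) ≈ scale c (shift (p ⊗ q))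
    shift-scale = ∷-cong (sym (ℤP.*-zeroʳ c)) ≈-refl
    factor : ∀ c a b u → c ℤ.* a ℤ.* b ℤ.+ c ℤ.* u ≡ c ℤ.* (a ℤ.* b ℤ.+ u)
    factor = solve-∀ℤ

  shift-⊗ : ∀ p q → shift p ⊗ q ≈ shift (p ⊗ q)
  shift-⊗ p q = mk≈ λ i → trans (coeff-∷⊗ (+ 0) p q i) (ℤP.+-identityˡ _)

  ⊗-zeroʳ : ∀ p → p ⊗ [] ≈ []
  ⊗-zeroʳ [] = ≈-refl
  ⊗-zeroʳ (a ∷ p) = ≈-trans (shift-cong (⊗-zeroʳ p)) shift-[]

  ⊗-∷ʳ : ∀ p b q → p ⊗ (b ∷ q) ≈ scale b p ⊕ shift (p ⊗ q)
  ⊗-∷ʳ [] b q = ≈-sym shift-[]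
  ⊗-∷ʳ (a ∷ p) b q = ∷-cong (cong (ℤ._+ + 0) (ℤP.*-comm a b)) (mk≈ λ i → begin
    coeff (scale a q ⊕ (p ⊗ (b ∷ q))) i
      ≡⟨ coeff-⊕ (scale a q) (p ⊗ (b ∷ q)) i ⟩
    coeff (scale a q) i ℤ.+ coeff (p ⊗ (b ∷ q)) i
      ≡⟨ cong (ℤ._+_ (coeff (scale a q) i)) (trans (at (⊗-∷ʳ p b q) i) (coeff-⊕ (scale b p) (shift (p ⊗ q)) i)) ⟩
    coeff (scale a q) i ℤ.+ (coeff (scale b p) i ℤ.+ coeff (shift (p ⊗ q)) i)
      ≡⟨ swap (coeff (scale a q) i) (coeff (scale b p) i) _ ⟩
    coeff (scale b p) i ℤ.+ (coeff (scale a q) i ℤ.+ coeff (shift (p ⊗ q)) i)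
      ≡⟨ cong (ℤ._+_ (coeff (scale b p) i)) (coeff-⊕ (scale a q) (shift (p ⊗ q)) i) ⟨
    coeff (scale b p) i ℤ.+ coeff (scale a q ⊕ shift (p ⊗ q)) i
      ≡⟨ coeff-⊕ (scale b p) (scale a q ⊕ shift (p ⊗ q)) i ⟨
    coeff (scale b p ⊕ (scale a q ⊕ shift (p ⊗ q))) i
      ∎)
    where
    open ≡-Reasoning
    swap : ∀ a b c → a ℤ.+ (b ℤ.+ c) ≡ b ℤ.+ (a ℤ.+ c)
    swap = solve-∀ℤ

  ⊗-comm : ∀ p q → p ⊗ q ≈ q ⊗ p
  ⊗-comm [] q = ≈-sym (⊗-zeroʳ q)
  ⊗-comm (a ∷ p) q = ≈-trans (⊕-cong ≈-refl (shift-cong (⊗-comm p q))) (≈-sym (⊗-∷ʳ q a p))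

  ⊗-assoc : ∀ p q r → (p ⊗ q) ⊗ r ≈ p ⊗ (q ⊗ r)
  ⊗-assoc [] q r = ≈-refl
  ⊗-assoc (a ∷ p) q r =
    ≈-trans (⊗-distribʳ (scale a q) (shift (p ⊗ q)) r)
      (⊕-cong (scale-⊗ a q r) (≈-trans (shift-⊗ (p ⊗ q) r) (shift-cong (⊗-assoc p q r))))

  ⊗-identityˡ : ∀ p → one ⊗ p ≈ p
  ⊗-identityˡ p = ≈-trans (⊕-cong scale-1 shift-[]) (⊕-identityʳ p)
    where
    scale-1 : scale (+ 1) p ≈ p
    scale-1 = mk≈ λ i → trans (coeff-scale (+ 1) p i) (ℤP.*-identityˡ _)

  ℤ[x] : CommutativeRing 0ℓ 0ℓ
  ℤ[x] = record
    { Carrier = Poly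
    ; _≈_ = _≈_
    ; _+_ = _⊕_
    ; _*_ = _⊗_
    ; -_ = neg
    ; 0# = []
    ; 1# = one
    ; isCommutativeRing = record
      { isRing = record
        { +-isAbelianGroup = record
          { isGroup = record
            { isMonoid = record
              { isSemigroup = record
                { isMagma = record
                  { isEquivalence = record { refl = ≈-refl ; sym = ≈-sym ; trans = ≈-trans }
                  ; ∙-cong = ⊕-cong }
                ; assoc = ⊕-assoc }
              ; identity = (λ _ → ≈-refl) , ⊕-identityʳ }
            ; inverse = ⊕-inverseˡ , ⊕-inverseʳ
            ; ⁻¹-cong = neg-cong }
          ; comm = ⊕-comm }
        ; *-cong = ⊗-cong
        ; *-assoc = ⊗-assoc
        ; *-identity = ⊗-identityˡ , (λ p → ≈-trans (⊗-comm p one) (⊗-identityˡ p))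
        ; distrib = (λ p q r → ≈-trans (⊗-comm p (q ⊕ r)) (≈-trans (⊗-distribʳ q r p) (⊕-cong (⊗-comm q p) (⊗-comm r p))))
                  , (λ p q r → ⊗-distribʳ q r p) }
      ; *-comm = ⊗-comm } }

  open CommutativeRing ℤ[x] using ()
    renaming (setoid to ℤ[x]-setoid; *-identityʳ to ⊗-identityʳ)

  module ≈-Reasoning = Relation.Binary.Reasoning.Setoid ℤ[x]-setoid

  []≈? : ∀ p → Maybe ([] ≈ p)
  []≈? [] = just ≈-refl
  []≈? (+ zero ∷ p) = Maybe.map (λ []≈p → ≈-sym (≈-trans (shift-cong (≈-sym []≈p)) shift-[])) ([]≈? p)
  []≈? (_ ∷ _) = nothing

  ℤ[x]-solver : ACR.AlmostCommutativeRing 0ℓ 0ℓ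
  ℤ[x]-solver = ACR.fromCommutativeRing ℤ[x] []≈?

  -- Degree bounds and monic polynomials

  DegreeBelow : ℕ → Poly → Set
  DegreeBelow N p = ∀ i → N ≤ i → coeff p i ≡ + 0

  record Monic (D : ℕ) (p : Poly) : Set where
    constructor monic
    field
      leading : coeff p D ≡ + 1
      bounded : DegreeBelow (suc D) p

  degreeBelow-length : ∀ p → DegreeBelow (length p) p
  degreeBelow-length [] i _ = refl
  degreeBelow-length (a ∷ p) (suc i) (s≤s h) = degreeBelow-length p i h

  degreeBelow-mono : ∀ {N M p} → N ≤ M → DegreeBelow N p → DegreeBelow M p
  degreeBelow-mono N≤M below i M≤i = below i (ℕP.≤-trans N≤M M≤i)

  degreeBelow-resp-≈ : ∀ {N p q} → p ≈ q → DegreeBelow N p → DegreeBelow N q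
  degreeBelow-resp-≈ p≈q below i h = trans (sym (at p≈q i)) (below i h)

  degreeBelow-⊕ : ∀ {N} p q → DegreeBelow N p → DegreeBelow N q → DegreeBelow N (p ⊕ q)
  degreeBelow-⊕ p q bp bq i h = trans (coeff-⊕ p q i) (cong₂ ℤ._+_ (bp i h) (bq i h))

  degreeBelow-neg : ∀ {N} p → DegreeBelow N p → DegreeBelow N (neg p)
  degreeBelow-neg p bp i h = trans (coeff-neg p i) (cong ℤ.-_ (bp i h))

  degreeBelow-0 : ∀ {p} → DegreeBelow 0 p → p ≈ []
  degreeBelow-0 below = mk≈ λ i → below i z≤n

  ≈[]⇒degreeBelow : ∀ {N p} → p ≈ [] → DegreeBelow N p
  ≈[]⇒degreeBelow p≈0 i _ = at p≈0 i

  degreeBelow-tail : ∀ {N a p} → DegreeBelow (suc N) (a ∷ p) → DegreeBelow N p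
  degreeBelow-tail below i h = below (suc i) (s≤s h)

  degreeBelow-⊗ : ∀ N M p q → DegreeBelow N p → DegreeBelow (suc M) q → DegreeBelow (N + M) (p ⊗ q)
  degreeBelow-⊗ N M [] q bp bq i h = refl
  degreeBelow-⊗ zero M (a ∷ p) q bp bq = ≈[]⇒degreeBelow (⊗-zeroˡ (a ∷ p) q (degreeBelow-0 bp))
  degreeBelow-⊗ (suc N) M (a ∷ p) q bp bq i h = begin
    coeff ((a ∷ p) ⊗ q) i                          ≡⟨ coeff-∷⊗ a p q i ⟩
    a ℤ.* coeff q i ℤ.+ coeff (shift (p ⊗ q)) i     ≡⟨ cong₂ ℤ._+_ (cong (a ℤ.*_) (bq i (ℕP.≤-trans (s≤s (ℕP.m≤n+m M N)) h)))
                                                                   (shifted i h) ⟩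
    a ℤ.* + 0 ℤ.+ + 0                              ≡⟨ cong (ℤ._+ + 0) (ℤP.*-zeroʳ a) ⟩
    + 0                                            ∎
    where
    open ≡-Reasoning
    shifted : ∀ i → suc (N + M) ≤ i → coeff (shift (p ⊗ q)) i ≡ + 0
    shifted (suc i) (s≤s h) = degreeBelow-⊗ N M p q (degreeBelow-tail bp) bq i h

  coeff-⊗-top : ∀ N M p q → DegreeBelow (suc N) p → DegreeBelow (suc M) q →
                coeff (p ⊗ q) (N + M) ≡ coeff p N ℤ.* coeff q M
  coeff-⊗-top N M [] q bp bq = refl
  coeff-⊗-top zero M (a ∷ p) q bp bq =
    trans (coeff-∷⊗ a p q M) (trans (cong (ℤ._+_ (a ℤ.* coeff q M)) (at p⊗q≈0 M)) (ℤP.+-identityʳ _))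
    where
    p⊗q≈0 : shift (p ⊗ q) ≈ []
    p⊗q≈0 = ≈-trans (shift-cong (⊗-zeroˡ p q (degreeBelow-0 (degreeBelow-tail bp)))) shift-[]
  coeff-⊗-top (suc N) M (a ∷ p) q bp bq =
    trans (coeff-∷⊗ a p q (suc N + M))
      (trans (cong₂ ℤ._+_ (trans (cong (a ℤ.*_) (bq (suc (N + M)) (s≤s (ℕP.m≤n+m M N)))) (ℤP.*-zeroʳ a))
                          (coeff-⊗-top N M p q (degreeBelow-tail bp) bq))
             (ℤP.+-identityˡ _))

  monic-⊗ : ∀ {D E p q} → Monic D p → Monic E q → Monic (D + E) (p ⊗ q)
  monic-⊗ {D} {E} {p} {q} (monic top-p bp) (monic top-q bq) = monic
    (trans (coeff-⊗-top D E p q bp bq) (cong₂ ℤ._*_ top-p top-q)) (degreeBelow-⊗ (suc D) E p q bp bq)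

  monic-resp-≈ : ∀ {D p q} → p ≈ q → Monic D p → Monic D q
  monic-resp-≈ p≈q (monic top below) = monic (trans (sym (at p≈q _)) top) (degreeBelow-resp-≈ p≈q below)

  monic-one : Monic 0 one
  monic-one = monic refl (degreeBelow-length one)

  1≢0 : ¬ (+ 1 ≡ + 0)
  1≢0 ()

  Degree : ℕ → Poly → Set
  Degree j p = DegreeBelow (suc j) p × ¬ (coeff p j ≡ + 0)

  zero-or-degree : ∀ p → p ≈ [] ⊎ Σ ℕ λ j → Degree j p
  zero-or-degree [] = inj₁ ≈-refl
  zero-or-degree (a ∷ p) with zero-or-degree p
  ... | inj₂ (j , below , top≢0) = inj₂ (suc j , (λ { (suc i) (s≤s h) → below i h }) , top≢0)
  ... | inj₁ p≈0 with a ℤ.≟ + 0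
  ...   | yes a≡0 = inj₁ (≈-trans (∷-cong a≡0 p≈0) shift-[])
  ...   | no a≢0 = inj₂ (zero , (λ { (suc i) _ → at p≈0 i }) , a≢0)

  coeff-⊗-monic-top : ∀ {j E m} q → DegreeBelow (suc j) q → Monic E m → coeff (q ⊗ m) (j + E) ≡ coeff q j
  coeff-⊗-monic-top {j} {E} {m} q bq (monic top bm) =
    trans (coeff-⊗-top j E q m bq bm) (trans (cong (coeff q j ℤ.*_) top) (ℤP.*-identityʳ _))

  degreeBelow-cancel-monic : ∀ {E m} q K → Monic E m → DegreeBelow (K + E) (q ⊗ m) → DegreeBelow K q
  degreeBelow-cancel-monic {E} {m} q K m-monic below with zero-or-degree q
  ... | inj₁ q≈0 = ≈[]⇒degreeBelow q≈0
  ... | inj₂ (j , bq , top≢0) with j <? K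
  ...   | yes j<K = degreeBelow-mono {p = q} j<K bq
  ...   | no j≮K = ⊥-elim (top≢0 (trans (sym (coeff-⊗-monic-top q bq m-monic))
                                          (below (j + E) (ℕP.+-monoˡ-≤ E (ℕP.≮⇒≥ j≮K)))))

  degreeBelow-monic-⇒≈[] : ∀ {E m} q → Monic E m → DegreeBelow E (q ⊗ m) → q ≈ []
  degreeBelow-monic-⇒≈[] q m-monic below = degreeBelow-0 (degreeBelow-cancel-monic q 0 m-monic below)

  ⊗-cancelʳ-monic : ∀ {E m} q r → Monic E m → q ⊗ m ≈ r ⊗ m → q ≈ r
  ⊗-cancelʳ-monic {m = m} q r m-monic qm≈rm = begin
    q                     ≈⟨ split q r ⟩
    (q ⊕ neg r) ⊕ r       ≈⟨ ⊕-cong difference≈0 ≈-refl ⟩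
    [] ⊕ r                ≡⟨⟩
    r                     ∎
    where
    open ≈-Reasoning
    split : ∀ q r → q ≈ ((q ⊕ neg r) ⊕ r)
    split = solve-∀ ℤ[x]-solver
    distrib : ∀ q r m → ((q ⊕ neg r) ⊗ m) ≈ ((q ⊗ m) ⊕ neg (r ⊗ m))
    distrib = solve-∀ ℤ[x]-solver
    difference≈0 : q ⊕ neg r ≈ []
    difference≈0 = degreeBelow-monic-⇒≈[] (q ⊕ neg r) m-monic (≈[]⇒degreeBelow
      (≈-trans (distrib q r m) (≈-trans (⊕-cong qm≈rm ≈-refl) (⊕-inverseʳ (r ⊗ m)))))

  monic-quotient : ∀ {D E m} q → Monic E m → Monic D (q ⊗ m) → E ≤ D × Monic (D ∸ E) q
  monic-quotient {D} {E} {m} q m-monic (monic top below) with zero-or-degree q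
  ... | inj₁ q≈0 = ⊥-elim (1≢0 (trans (sym top) (at (⊗-zeroˡ q m q≈0) D)))
  ... | inj₂ (j , bq , top≢0) = E≤D , subst (λ k → Monic k q) j≡D∸E (monic q-top bq)
    where
    top-qm : coeff (q ⊗ m) (j + E) ≡ coeff q j
    top-qm = coeff-⊗-monic-top q bq m-monic
    D≤j+E : D ≤ j + E
    D≤j+E with D ≤? j + E
    ... | yes h = h
    ... | no h = ⊥-elim (1≢0 (trans (sym top) (degreeBelow-⊗ (suc j) E q m bq (Monic.bounded m-monic) D (ℕP.≰⇒> h))))
    j+E≤D : j + E ≤ D
    j+E≤D with j + E ≤? D
    ... | yes h = h
    ... | no h = ⊥-elim (top≢0 (trans (sym top-qm) (below (j + E) (ℕP.≰⇒> h))))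
    j+E≡D : j + E ≡ D
    j+E≡D = ℕP.≤-antisym j+E≤D D≤j+E
    E≤D : E ≤ D
    E≤D = subst (E ≤_) j+E≡D (ℕP.m≤n+m E j)
    j≡D∸E : j ≡ D ∸ E
    j≡D∸E = trans (sym (ℕP.m+n∸n≡m j E)) (cong (_∸ E) j+E≡D)
    q-top : coeff q j ≡ + 1
    q-top = trans (sym top-qm) (trans (cong (coeff (q ⊗ m)) j+E≡D) top)

  monomial : ℕ → ℤ → Poly
  monomial k c = replicate k (+ 0) ++ [ c ]ₚ

  coeff-monomial : ∀ k c → coeff (monomial k c) k ≡ c
  coeff-monomial zero c = refl
  coeff-monomial (suc k) c = coeff-monomial k c

  degreeBelow-monomial : ∀ k c → DegreeBelow (suc k) (monomial k c)
  degreeBelow-monomial zero c (suc i) _ = refl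
  degreeBelow-monomial (suc k) c (suc i) (s≤s h) = degreeBelow-monomial k c i h

  record Division (m A : Poly) (E : ℕ) : Set where
    field
      quotient remainder : Poly
      equation : A ≈ ((quotient ⊗ m) ⊕ remainder)
      remainder-degree : DegreeBelow E remainder

  divide : ∀ N A {E m} → Monic E m → DegreeBelow N A → Division m A E
  divide zero A m-monic below = record
    { quotient = [] ; remainder = A ; equation = ≈-refl ; remainder-degree = degreeBelow-mono {p = A} z≤n below }
  divide (suc N) A {E} {m} m-monic below with suc N ≤? E
  ... | yes N<E = record
    { quotient = [] ; remainder = A ; equation = ≈-refl ; remainder-degree = degreeBelow-mono {p = A} N<E below }
  ... | no N≮E = record
    { quotient = quotient ⊕ T ; remainder = remainder ; equation = equation′ ; remainder-degree = remainder-degree }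
    where
    k = N ∸ E
    k+E≡N : k + E ≡ N
    k+E≡N = ℕP.m∸n+n≡m (ℕP.≤-pred (ℕP.≰⇒> N≮E))
    c = coeff A N
    T = monomial k c
    Tm-degree : DegreeBelow (suc N) (T ⊗ m)
    Tm-degree = subst (λ n → DegreeBelow (suc n) (T ⊗ m)) k+E≡N
                  (degreeBelow-⊗ (suc k) E T m (degreeBelow-monomial k c) (Monic.bounded m-monic))
    Tm-top : coeff (T ⊗ m) N ≡ c
    Tm-top = trans (cong (coeff (T ⊗ m)) (sym k+E≡N))
                   (trans (coeff-⊗-monic-top T (degreeBelow-monomial k c) m-monic) (coeff-monomial k c))
    A′ = A ⊕ neg (T ⊗ m)
    A′-degree : DegreeBelow N A′
    A′-degree i N≤i with N ℕ.≟ i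
    ... | yes refl = trans (coeff-⊕ A (neg (T ⊗ m)) N)
                       (trans (cong (ℤ._+_ c) (trans (coeff-neg (T ⊗ m) N) (cong ℤ.-_ Tm-top))) (ℤP.+-inverseʳ c))
    ... | no N≢i = degreeBelow-⊕ A (neg (T ⊗ m)) below (degreeBelow-neg (T ⊗ m) Tm-degree) i (ℕP.≤∧≢⇒< N≤i N≢i)
    open Division (divide N A′ {m = m} m-monic A′-degree)
    equation′ : A ≈ (((quotient ⊕ T) ⊗ m) ⊕ remainder)
    equation′ = begin
      A                                          ≈⟨ add-back A (T ⊗ m) ⟩
      A′ ⊕ (T ⊗ m)                               ≈⟨ ⊕-cong equation ≈-refl ⟩
      ((quotient ⊗ m) ⊕ remainder) ⊕ (T ⊗ m)     ≈⟨ regroup quotient m remainder T ⟩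
      ((quotient ⊕ T) ⊗ m) ⊕ remainder           ∎
      where
      open ≈-Reasoning
      add-back : ∀ A X → A ≈ ((A ⊕ neg X) ⊕ X)
      add-back = solve-∀ ℤ[x]-solver
      regroup : ∀ Q m R T → (((Q ⊗ m) ⊕ R) ⊕ (T ⊗ m)) ≈ (((Q ⊕ T) ⊗ m) ⊕ R)
      regroup = solve-∀ ℤ[x]-solver

  infix 4 _∣ₚ_
  _∣ₚ_ : Poly → Poly → Set
  m ∣ₚ A = Σ Poly λ Q → A ≈ (Q ⊗ m)

  coeff-[]ₚ⊗ : ∀ c R i → coeff ([ c ]ₚ ⊗ R) i ≡ c ℤ.* coeff R i
  coeff-[]ₚ⊗ c R i = trans (coeff-∷⊗ c [] R i) (trans (cong (ℤ._+_ (c ℤ.* coeff R i)) (coeff-shift-[] i)) (ℤP.+-identityʳ _))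

  -- Division with remainder: S m = c (Q m + R) forces (S − c Q) m = c R, of degree < deg m.
  monic-∣-cancel-constant : ∀ {E m} c A → Monic E m → ¬ (c ≡ + 0) → m ∣ₚ ([ c ]ₚ ⊗ A) → m ∣ₚ A
  monic-∣-cancel-constant {E} {m} c A m-monic c≢0 (S , cA≈Sm) =
    quotient , ≈-trans equation (≈-trans (⊕-cong ≈-refl remainder≈0) (⊕-identityʳ (quotient ⊗ m)))
    where
    open Division (divide (length A) A {m = m} m-monic (degreeBelow-length A))
    D = S ⊕ neg ([ c ]ₚ ⊗ quotient)
    Dm≈cR : D ⊗ m ≈ [ c ]ₚ ⊗ remainder
    Dm≈cR = begin
      D ⊗ m                                                              ≈⟨ distrib S [ c ]ₚ quotient m ⟩
      (S ⊗ m) ⊕ neg ([ c ]ₚ ⊗ (quotient ⊗ m))                            ≈⟨ ⊕-cong (≈-trans (≈-sym cA≈Sm) (⊗-congʳ [ c ]ₚ equation)) ≈-refl ⟩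
      ([ c ]ₚ ⊗ ((quotient ⊗ m) ⊕ remainder)) ⊕ neg ([ c ]ₚ ⊗ (quotient ⊗ m)) ≈⟨ cancel [ c ]ₚ quotient m remainder ⟩
      [ c ]ₚ ⊗ remainder                                                 ∎
      where
      open ≈-Reasoning
      distrib : ∀ S n Q m → ((S ⊕ neg (n ⊗ Q)) ⊗ m) ≈ ((S ⊗ m) ⊕ neg (n ⊗ (Q ⊗ m)))
      distrib = solve-∀ ℤ[x]-solver
      cancel : ∀ n Q m R → ((n ⊗ ((Q ⊗ m) ⊕ R)) ⊕ neg (n ⊗ (Q ⊗ m))) ≈ (n ⊗ R)
      cancel = solve-∀ ℤ[x]-solver
    cR-degree : DegreeBelow E ([ c ]ₚ ⊗ remainder)
    cR-degree i h = trans (coeff-[]ₚ⊗ c remainder i) (trans (cong (c ℤ.*_) (remainder-degree i h)) (ℤP.*-zeroʳ c))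
    cR≈0 : [ c ]ₚ ⊗ remainder ≈ []
    cR≈0 = ≈-trans (≈-sym Dm≈cR) (⊗-zeroˡ D m (degreeBelow-monic-⇒≈[] D m-monic (degreeBelow-resp-≈ (≈-sym Dm≈cR) cR-degree)))
    remainder≈0 : remainder ≈ []
    remainder≈0 = mk≈ λ i → remainder-coeff i (ℤP.i*j≡0⇒i≡0∨j≡0 c (trans (sym (coeff-[]ₚ⊗ c remainder i)) (at cR≈0 i)))
      where
      remainder-coeff : ∀ i → c ≡ + 0 ⊎ coeff remainder i ≡ + 0 → coeff remainder i ≡ + 0
      remainder-coeff i (inj₁ c≡0) = ⊥-elim (c≢0 c≡0)
      remainder-coeff i (inj₂ r≡0) = r≡0

  infix 30 x^_
  x^_ : ℕ → Poly
  x^ k = monomial k (+ 1)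

  replicate-++ : ∀ k p → replicate k (+ 0) ++ p ≈ x^ k ⊗ p
  replicate-++ zero p = ≈-sym (⊗-identityˡ p)
  replicate-++ (suc k) p = ≈-trans (shift-cong (replicate-++ k p)) (≈-sym (shift-⊗ (x^ k) p))

  ++-≈ : ∀ ys zs → ys ++ zs ≈ ys ⊕ (x^ (length ys) ⊗ zs)
  ++-≈ [] zs = ≈-sym (⊗-identityˡ zs)
  ++-≈ (y ∷ ys) zs =
    ≈-trans (∷-cong (sym (ℤP.+-identityʳ y)) (++-≈ ys zs)) (⊕-cong {y ∷ ys} ≈-refl (≈-sym (shift-⊗ (x^ length ys) zs)))

  x^-+ : ∀ a b → x^ (a + b) ≈ x^ a ⊗ x^ b
  x^-+ zero b = ≈-sym (⊗-identityˡ (x^ b))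
  x^-+ (suc a) b = ≈-trans (shift-cong (x^-+ a b)) (≈-sym (shift-⊗ (x^ a) (x^ b)))

  reverse-∷ : ∀ c xs → reverse (c ∷ xs) ≈ reverse xs ⊕ (x^ length xs ⊗ [ c ]ₚ)
  reverse-∷ c xs rewrite List.unfold-reverse c xs =
    subst (λ n → reverse xs ++ [ c ]ₚ ≈ reverse xs ⊕ (x^ n ⊗ [ c ]ₚ)) (List.length-reverse xs) (++-≈ (reverse xs) [ c ]ₚ)

  coeff-++ʳ : ∀ ys zs j → coeff (ys ++ zs) (length ys + j) ≡ coeff zs j
  coeff-++ʳ [] zs j = refl
  coeff-++ʳ (y ∷ ys) zs j = coeff-++ʳ ys zs j

  coeff-reverse-∷ : ∀ c bs → coeff (reverse (c ∷ bs)) (length bs) ≡ c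
  coeff-reverse-∷ c bs rewrite List.unfold-reverse c bs =
    subst (λ n → coeff (reverse bs ++ [ c ]ₚ) n ≡ c) (trans (ℕP.+-identityʳ _) (List.length-reverse bs))
      (coeff-++ʳ (reverse bs) [ c ]ₚ 0)

  degreeBelow-reverse : ∀ as → DegreeBelow (length as) (reverse as)
  degreeBelow-reverse as = subst (λ n → DegreeBelow n (reverse as)) (List.length-reverse as) (degreeBelow-length (reverse as))

  monic-reverse-1∷ : ∀ bs → Monic (length bs) (reverse (+ 1 ∷ bs))
  monic-reverse-1∷ bs = monic (coeff-reverse-∷ (+ 1) bs) (degreeBelow-reverse (+ 1 ∷ bs))

  -- Correctness of monicQuot

  -- The helpers of normalize and monicQuot are private to Defs; the metavariables below are solved by
  -- unification against their definitions, which recovers them under these names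
  -- (subFrontScaled c as bs is subFront as (map (c *_) bs)).
  mutual
    divHF : ℕ → List ℤ → List ℤ → List ℤ
    divHF = _

    subFrontScaled : ℤ → List ℤ → List ℤ → List ℤ
    subFrontScaled = _

    dropZ : Poly → List ℤ → List ℤ
    dropZ = _

    monicQuotDef : Poly → Poly → Poly
    monicQuotDef a b with reverse (normalize b)
    ... | [] = []
    ... | _ ∷ bs = reverse (divHF (length a) (reverse (normalize a)) bs)

    monicQuot-unfold : ∀ a b → monicQuot a b ≡ monicQuotDef a b
    monicQuot-unfold a b with reverse (normalize b)
    ... | [] = refl
    ... | _ ∷ bs with length a | reverse (normalize a)
    ... | _ | _ with reverse {A = ℤ}
    ... | _ = refl

    divHF-unfold : ∀ f c as bs → divHF (suc f) (c ∷ as) bs ≡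
      (if does (length bs ≤? length as) then c ∷ divHF f (subFrontScaled c as bs) bs else [])
    divHF-unfold f c as bs = refl

    normalize-unfold : ∀ p → normalize p ≡ reverse (dropZ p (reverse p))
    normalize-unfold p with reverse p
    ... | _ with reverse {A = ℤ}
    ... | _ = refl

  dropZ-reverse : ∀ p ys → reverse (dropZ p ys) ≈ reverse ys
  dropZ-reverse p [] = ≈-refl
  dropZ-reverse p (+ zero ∷ ys) = ≈-trans (dropZ-reverse p ys) (≈-sym (begin
    reverse (+ 0 ∷ ys)                          ≈⟨ reverse-∷ (+ 0) ys ⟩
    reverse ys ⊕ (x^ length ys ⊗ [ + 0 ]ₚ)       ≈⟨ ⊕-cong ≈-refl (≈-trans (⊗-congʳ (x^ length ys) shift-[]) (⊗-zeroʳ (x^ length ys))) ⟩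
    reverse ys ⊕ []                             ≈⟨ ⊕-identityʳ (reverse ys) ⟩
    reverse ys                                  ∎))
    where open ≈-Reasoning
  dropZ-reverse p (+ suc n ∷ ys) = ≈-refl
  dropZ-reverse p (-[1+ n ] ∷ ys) = ≈-refl

  dropZ-length : ∀ p ys → length (dropZ p ys) ≤ length ys
  dropZ-length p [] = z≤n
  dropZ-length p (+ zero ∷ ys) = ℕP.m≤n⇒m≤1+n (dropZ-length p ys)
  dropZ-length p (+ suc n ∷ ys) = ℕP.≤-refl
  dropZ-length p (-[1+ n ] ∷ ys) = ℕP.≤-refl

  dropZ-head : ∀ p ys → dropZ p ys ≡ [] ⊎ Σ ℤ λ y → Σ (List ℤ) λ bs → dropZ p ys ≡ y ∷ bs × ¬ (y ≡ + 0)
  dropZ-head p [] = inj₁ refl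
  dropZ-head p (+ zero ∷ ys) = dropZ-head p ys
  dropZ-head p (+ suc n ∷ ys) = inj₂ (+ suc n , ys , refl , λ ())
  dropZ-head p (-[1+ n ] ∷ ys) = inj₂ (-[1+ n ] , ys , refl , λ ())

  reverse-normalize : ∀ p → reverse (normalize p) ≡ dropZ p (reverse p)
  reverse-normalize p = trans (cong reverse (normalize-unfold p)) (List.reverse-involutive (dropZ p (reverse p)))

  reverse-dropZ-reverse : ∀ p → reverse (dropZ p (reverse p)) ≈ p
  reverse-dropZ-reverse p = subst (reverse (dropZ p (reverse p)) ≈_) (List.reverse-involutive p) (dropZ-reverse p (reverse p))

  normalize≈ : ∀ p → normalize p ≈ p
  normalize≈ p = subst (_≈ p) (sym (normalize-unfold p)) (reverse-dropZ-reverse p)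

  monic-dropZ : ∀ {E m} → Monic E m → Σ (List ℤ) λ bs → dropZ m (reverse m) ≡ + 1 ∷ bs × length bs ≡ E
  monic-dropZ {E} {m} (monic top below) with dropZ-head m (reverse m)
  ... | inj₁ empty = ⊥-elim (1≢0 (trans (sym top)
          (trans (sym (at (reverse-dropZ-reverse m) E)) (cong (λ z → coeff (reverse z) E) empty))))
  ... | inj₂ (y , bs , nonempty , y≢0) = bs , trans nonempty (cong (_∷ bs) y≡1) , length≡E
    where
    y∷bs≈m : reverse (y ∷ bs) ≈ m
    y∷bs≈m = subst (λ z → reverse z ≈ m) nonempty (reverse-dropZ-reverse m)
    coeff-y : coeff m (length bs) ≡ y
    coeff-y = trans (sym (at y∷bs≈m (length bs))) (coeff-reverse-∷ y bs)
    length≤E : length bs ≤ E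
    length≤E with length bs ≤? E
    ... | yes h = h
    ... | no h = ⊥-elim (y≢0 (trans (sym coeff-y) (below (length bs) (ℕP.≰⇒> h))))
    E≤length : E ≤ length bs
    E≤length with E ≤? length bs
    ... | yes h = h
    ... | no h = ⊥-elim (1≢0 (trans (sym top) (trans (sym (at y∷bs≈m E)) (degreeBelow-reverse (y ∷ bs) E (ℕP.≰⇒> h)))))
    length≡E : length bs ≡ E
    length≡E = ℕP.≤-antisym length≤E E≤length
    y≡1 : y ≡ + 1
    y≡1 = trans (sym coeff-y) (trans (cong (coeff m) length≡E) top)

  length-subFrontScaled : ∀ c as bs → length bs ≤ length as → length (subFrontScaled c as bs) ≡ length as
  length-subFrontScaled c as [] _ = refl
  length-subFrontScaled c (x ∷ as) (b ∷ bs) (s≤s h) = cong suc (length-subFrontScaled c as bs h)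

  reverse-subFrontScaled : ∀ c as bs → length bs ≤ length as →
    reverse (subFrontScaled c as bs) ≈ reverse as ⊕ neg ([ c ]ₚ ⊗ (x^ (length as ∸ length bs) ⊗ reverse bs))
  reverse-subFrontScaled c as [] _ = ≈-sym (drop-zero (reverse as) [ c ]ₚ (x^ length as))
    where
    drop-zero : ∀ A C X → (A ⊕ neg (C ⊗ (X ⊗ []))) ≈ A
    drop-zero = solve-∀ ℤ[x]-solver
  reverse-subFrontScaled c (x ∷ as) (b ∷ bs) (s≤s h) = begin
    reverse ((x ℤ.- c ℤ.* b) ∷ S)
      ≈⟨ reverse-∷ (x ℤ.- c ℤ.* b) S ⟩
    reverse S ⊕ (x^ length S ⊗ [ x ℤ.- c ℤ.* b ]ₚ)
      ≈⟨ ⊕-cong (reverse-subFrontScaled c as bs h)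
                (⊗-cong (≡⇒≈ (cong x^_ (trans (length-subFrontScaled c as bs h) (sym (ℕP.m∸n+n≡m h))))) difference) ⟩
    (reverse as ⊕ neg ([ c ]ₚ ⊗ (K ⊗ reverse bs))) ⊕ (x^ (k + length bs) ⊗ ([ x ]ₚ ⊕ neg ([ c ]ₚ ⊗ [ b ]ₚ)))
      ≈⟨ ⊕-cong ≈-refl (⊗-congˡ _ (x^-+ k (length bs))) ⟩
    (reverse as ⊕ neg ([ c ]ₚ ⊗ (K ⊗ reverse bs))) ⊕ ((K ⊗ Y) ⊗ ([ x ]ₚ ⊕ neg ([ c ]ₚ ⊗ [ b ]ₚ)))
      ≈⟨ regroup (reverse as) [ c ]ₚ K Y (reverse bs) [ x ]ₚ [ b ]ₚ ⟩
    (reverse as ⊕ ((K ⊗ Y) ⊗ [ x ]ₚ)) ⊕ neg ([ c ]ₚ ⊗ (K ⊗ (reverse bs ⊕ (Y ⊗ [ b ]ₚ))))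
      ≈⟨ ⊕-cong (≈-trans (⊕-cong ≈-refl (⊗-congˡ _ (≈-trans (≈-sym (x^-+ k (length bs))) (≡⇒≈ (cong x^_ (ℕP.m∸n+n≡m h))))))
                          (≈-sym (reverse-∷ x as)))
                (neg-cong (⊗-congʳ [ c ]ₚ (⊗-congʳ K (≈-sym (reverse-∷ b bs))))) ⟩
    reverse (x ∷ as) ⊕ neg ([ c ]ₚ ⊗ (K ⊗ reverse (b ∷ bs)))
      ∎
    where
    open ≈-Reasoning
    S = subFrontScaled c as bs
    k = length as ∸ length bs
    K = x^ k
    Y = x^ length bs
    difference : [ x ℤ.- c ℤ.* b ]ₚ ≈ [ x ]ₚ ⊕ neg ([ c ]ₚ ⊗ [ b ]ₚ)
    difference = ∷-cong (cong (λ z → x ℤ.+ ℤ.- z) (sym (ℤP.+-identityʳ (c ℤ.* b)))) ≈-refl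
    regroup : ∀ RA C K Y RB X B → (((RA ⊕ neg (C ⊗ (K ⊗ RB))) ⊕ ((K ⊗ Y) ⊗ (X ⊕ neg (C ⊗ B)))))
                                   ≈ ((RA ⊕ ((K ⊗ Y) ⊗ X)) ⊕ neg (C ⊗ (K ⊗ (RB ⊕ (Y ⊗ B)))))
    regroup = solve-∀ ℤ[x]-solver

  fuel-subFrontScaled : ∀ {f} c as bs → length bs ≤ length as → suc (length as) ∸ length bs ≤ suc f →
                        length (subFrontScaled c as bs) ∸ length bs ≤ f
  fuel-subFrontScaled {f} c as bs bs≤as fuel rewrite length-subFrontScaled c as bs bs≤as =
    ℕP.≤-pred (subst (_≤ suc f) (ℕP.+-∸-assoc 1 bs≤as) fuel)

  divHF-fits : ∀ f c as bs → length bs ≤ length as → divHF (suc f) (c ∷ as) bs ≡ c ∷ divHF f (subFrontScaled c as bs) bs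
  divHF-fits f c as bs bs≤as rewrite divHF-unfold f c as bs | dec-true (length bs ≤? length as) bs≤as = refl

  divHF-stops : ∀ f c as bs → ¬ length bs ≤ length as → divHF (suc f) (c ∷ as) bs ≡ []
  divHF-stops f c as bs bs≰as rewrite divHF-unfold f c as bs | dec-false (length bs ≤? length as) bs≰as = refl

  length-divHF : ∀ f as bs → length as ∸ length bs ≤ f → length (divHF f as bs) ≡ length as ∸ length bs
  length-divHF zero as bs fuel = sym (ℕP.n≤0⇒n≡0 fuel)
  length-divHF (suc f) [] bs fuel = sym (ℕP.0∸n≡0 (length bs))
  length-divHF (suc f) (c ∷ as) bs fuel with length bs ≤? length as
  ... | yes bs≤as rewrite divHF-fits f c as bs bs≤as = begin
    suc (length (divHF f (subFrontScaled c as bs) bs))   ≡⟨ cong suc (length-divHF f _ bs (fuel-subFrontScaled c as bs bs≤as fuel)) ⟩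
    suc (length (subFrontScaled c as bs) ∸ length bs)    ≡⟨ cong (λ n → suc (n ∸ length bs)) (length-subFrontScaled c as bs bs≤as) ⟩
    suc (length as ∸ length bs)                          ≡⟨ ℕP.+-∸-assoc 1 bs≤as ⟨
    suc (length as) ∸ length bs                          ∎
    where open ≡-Reasoning
  ... | no bs≰as rewrite divHF-stops f c as bs bs≰as = sym (ℕP.m≤n⇒m∸n≡0 (ℕP.≰⇒> bs≰as))

  quotient-of-short : ∀ as bs Q → length as ≤ length bs → reverse as ≈ Q ⊗ reverse (+ 1 ∷ bs) → Q ≈ []
  quotient-of-short as bs Q as≤bs eq = degreeBelow-monic-⇒≈[] Q (monic-reverse-1∷ bs)
    (degreeBelow-resp-≈ eq (degreeBelow-mono {p = reverse as} as≤bs (degreeBelow-reverse as)))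

  divHF-correct : ∀ f as bs Q → length as ∸ length bs ≤ f → reverse as ≈ Q ⊗ reverse (+ 1 ∷ bs) →
                  reverse (divHF f as bs) ≈ Q
  divHF-correct zero as bs Q fuel eq =
    ≈-sym (quotient-of-short as bs Q (ℕP.m∸n≡0⇒m≤n (ℕP.n≤0⇒n≡0 fuel)) eq)
  divHF-correct (suc f) [] bs Q fuel eq = ≈-sym (quotient-of-short [] bs Q z≤n eq)
  divHF-correct (suc f) (c ∷ as) bs Q fuel eq with length bs ≤? length as
  ... | no bs≰as rewrite divHF-stops f c as bs bs≰as = ≈-sym (quotient-of-short (c ∷ as) bs Q (ℕP.≰⇒> bs≰as) eq)
  ... | yes bs≤as rewrite divHF-fits f c as bs bs≤as = begin
    reverse (c ∷ out)                ≈⟨ reverse-∷ c out ⟩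
    reverse out ⊕ (x^ length out ⊗ [ c ]ₚ)
      ≈⟨ ⊕-cong (divHF-correct f (subFrontScaled c as bs) bs Q′ fuel′ eq′) (⊗-congˡ [ c ]ₚ (≡⇒≈ (cong x^_ length-out))) ⟩
    Q′ ⊕ (K ⊗ [ c ]ₚ)               ≈⟨ add-back Q [ c ]ₚ K ⟩
    Q                                ∎
    where
    open ≈-Reasoning
    K = x^ (length as ∸ length bs)
    B = reverse (+ 1 ∷ bs)
    Q′ = Q ⊕ neg ([ c ]ₚ ⊗ K)
    fuel′ : length (subFrontScaled c as bs) ∸ length bs ≤ f
    fuel′ = fuel-subFrontScaled c as bs bs≤as fuel
    out = divHF f (subFrontScaled c as bs) bs
    length-out : length out ≡ length as ∸ length bs
    length-out = trans (length-divHF f _ bs fuel′) (cong (_∸ length bs) (length-subFrontScaled c as bs bs≤as))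
    x^as≈KY : x^ length as ≈ K ⊗ x^ length bs
    x^as≈KY = ≈-trans (≡⇒≈ (cong x^_ (sym (ℕP.m∸n+n≡m bs≤as)))) (x^-+ (length as ∸ length bs) (length bs))
    eq′ : reverse (subFrontScaled c as bs) ≈ Q′ ⊗ B
    eq′ = begin
      reverse (subFrontScaled c as bs)                  ≈⟨ reverse-subFrontScaled c as bs bs≤as ⟩
      reverse as ⊕ neg ([ c ]ₚ ⊗ (K ⊗ reverse bs))
        ≈⟨ ≈-sym (lead-term (reverse as) K (x^ length bs) [ c ]ₚ (reverse bs)) ⟩
      (reverse as ⊕ ((K ⊗ x^ length bs) ⊗ [ c ]ₚ)) ⊕ neg ([ c ]ₚ ⊗ (K ⊗ (reverse bs ⊕ (x^ length bs ⊗ one))))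
        ≈⟨ ⊕-cong (≈-trans (⊕-cong ≈-refl (⊗-congˡ _ (≈-sym x^as≈KY))) (≈-sym (reverse-∷ c as)))
                  (neg-cong (⊗-congʳ [ c ]ₚ (⊗-congʳ K (≈-sym (reverse-∷ (+ 1) bs))))) ⟩
      reverse (c ∷ as) ⊕ neg ([ c ]ₚ ⊗ (K ⊗ B))         ≈⟨ ⊕-cong eq ≈-refl ⟩
      (Q ⊗ B) ⊕ neg ([ c ]ₚ ⊗ (K ⊗ B))                  ≈⟨ factor Q [ c ]ₚ K B ⟩
      Q′ ⊗ B                                            ∎
      where
      lead-term : ∀ RA K Y C RB → ((RA ⊕ ((K ⊗ Y) ⊗ C)) ⊕ neg (C ⊗ (K ⊗ (RB ⊕ (Y ⊗ one))))) ≈ (RA ⊕ neg (C ⊗ (K ⊗ RB)))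
      lead-term = solve-∀ ℤ[x]-solver
      factor : ∀ Q C K B → ((Q ⊗ B) ⊕ neg (C ⊗ (K ⊗ B))) ≈ ((Q ⊕ neg (C ⊗ K)) ⊗ B)
      factor = solve-∀ ℤ[x]-solver
    add-back : ∀ Q C K → ((Q ⊕ neg (C ⊗ K)) ⊕ (K ⊗ C)) ≈ Q
    add-back = solve-∀ ℤ[x]-solver

  monicQuot-correct : ∀ {E m} A Q → Monic E m → A ≈ Q ⊗ m → monicQuot A m ≈ Q
  monicQuot-correct {E} {m} A Q m-monic A≈Qm with monic-dropZ m-monic
  ... | bs , m-digits , _ = subst (_≈ Q) (sym unfold) (divHF-correct (length A) as bs Q fuel eq)
    where
    as = dropZ A (reverse A)
    unfold : monicQuot A m ≡ reverse (divHF (length A) as bs)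
    unfold rewrite monicQuot-unfold A m | reverse-normalize m | m-digits | reverse-normalize A = refl
    fuel : length as ∸ length bs ≤ length A
    fuel = ℕP.≤-trans (ℕP.m∸n≤m (length as) (length bs))
                      (subst (length as ≤_) (List.length-reverse A) (dropZ-length A (reverse A)))
    eq : reverse as ≈ Q ⊗ reverse (+ 1 ∷ bs)
    eq = ≈-trans (reverse-dropZ-reverse A)
           (≈-trans A≈Qm (⊗-congʳ Q (≈-sym (subst (λ z → reverse z ≈ m) m-digits (reverse-dropZ-reverse m)))))

  -- Ψ n as a product of the Φ d

  Ψ : ℕ → Poly
  Ψ n = PsiAux n n

  Φ : ℕ → Poly
  Φ d = monicQuot (xPowMinusOne d) (Ψ d)

  properDivisors-< : ∀ n → All (_< n) (properDivisors n)
  properDivisors-< n = All.filter⁺ (_∣? n) (All.applyUpTo⁺₁ id n id)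

  foldr-cong-All : ∀ {P : ℕ → Set} {f g : ℕ → Poly → Poly} z ds → All P ds → (∀ {d} → P d → ∀ acc → f d acc ≡ g d acc) →
                   foldr f z ds ≡ foldr g z ds
  foldr-cong-All z [] [] f≗g = refl
  foldr-cong-All {g = g} z (d ∷ ds) (pd ∷ pds) f≗g = trans (f≗g pd _) (cong (g d) (foldr-cong-All z ds pds f≗g))

  PsiAux-fuel : ∀ f g n → n ≤ f → n ≤ g → PsiAux f n ≡ PsiAux g n
  PsiAux-fuel zero zero n _ _ = refl
  PsiAux-fuel zero (suc g) zero _ _ = refl
  PsiAux-fuel (suc f) zero zero _ _ = refl
  PsiAux-fuel (suc f) (suc g) n n≤f n≤g = foldr-cong-All one (properDivisors n) (properDivisors-< n) λ {d} d<n acc →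
    cong (λ Ψd → normalize (monicQuot (xPowMinusOne d) Ψd ⊗ acc))
         (PsiAux-fuel f g d (ℕP.≤-pred (ℕP.≤-trans d<n n≤f)) (ℕP.≤-pred (ℕP.≤-trans d<n n≤g)))

  Σ< : ℕ → (ℕ → ℕ) → ℕ
  Σ< zero f = 0
  Σ< (suc N) f = Σ< N f + f N

  product< : ∀ {P : ℕ → Set} → Decidable P → (ℕ → Poly) → ℕ → Poly
  product< P? F zero = one
  product< P? F (suc N) = product< P? F N ⊗ (if does (P? N) then F N else one)

  productList : (ℕ → Poly) → List ℕ → Poly
  productList F = foldr (λ d acc → F d ⊗ acc) one

  productList-++ : ∀ F xs ys → productList F (xs ++ ys) ≈ productList F xs ⊗ productList F ys
  productList-++ F [] ys = ≈-sym (⊗-identityˡ (productList F ys))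
  productList-++ F (x ∷ xs) ys =
    ≈-trans (⊗-congʳ (F x) (productList-++ F xs ys)) (≈-sym (⊗-assoc (F x) (productList F xs) (productList F ys)))

  productList-filter-upTo : ∀ {P : ℕ → Set} (P? : Decidable P) F N → productList F (filter P? (upTo N)) ≈ product< P? F N
  productList-filter-upTo P? F zero = ≈-refl
  productList-filter-upTo P? F (suc N) =
    subst (λ ds → productList F (filter P? ds) ≈ product< P? F (suc N)) (List.upTo-∷ʳ N) (begin
      productList F (filter P? (upTo N ++ N ∷ []))               ≡⟨ cong (productList F) (List.filter-++ P? (upTo N) (N ∷ [])) ⟩
      productList F (filter P? (upTo N) ++ filter P? (N ∷ []))   ≈⟨ productList-++ F (filter P? (upTo N)) (filter P? (N ∷ [])) ⟩
      productList F (filter P? (upTo N)) ⊗ productList F (filter P? (N ∷ []))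
                                                                 ≈⟨ ⊗-cong (productList-filter-upTo P? F N) last ⟩
      product< P? F (suc N)                                      ∎)
    where
    open ≈-Reasoning
    last : productList F (filter P? (N ∷ [])) ≈ (if does (P? N) then F N else one)
    last with P? N
    ... | yes _ = ⊗-identityʳ (F N)
    ... | no _ = ≈-refl

  Ψ≈product : ∀ n → Ψ n ≈ product< (_∣? n) Φ n
  Ψ≈product zero = ≈-refl
  Ψ≈product (suc n) = ≈-trans (steps (properDivisors (suc n)) (properDivisors-< (suc n)))
                        (productList-filter-upTo (_∣? suc n) Φ (suc n))
    where
    steps : ∀ ds → All (_< suc n) ds →
            foldr (λ d acc → normalize (monicQuot (xPowMinusOne d) (PsiAux n d) ⊗ acc)) one ds ≈ productList Φ ds
    steps [] [] = ≈-refl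
    steps (d ∷ ds) (d<n ∷ ds<n) = ≈-trans (normalize≈ _)
      (⊗-cong (≡⇒≈ (cong (monicQuot (xPowMinusOne d)) (PsiAux-fuel n d d (ℕP.≤-pred d<n) ℕP.≤-refl))) (steps ds ds<n))

  Psi≈Ψ : ∀ n → Psi n ≈ Ψ n
  Psi≈Ψ n = normalize≈ (PsiAux n n)

  xPowMinusOne≈ : ∀ n → xPowMinusOne n ≈ x^ n ⊕ neg one
  xPowMinusOne≈ zero = ≈-sym shift-[]
  xPowMinusOne≈ (suc k) = ∷-cong refl (≈-sym (⊕-identityʳ (x^ k)))

  monic-xPowMinusOne : ∀ k → Monic (suc k) (xPowMinusOne (suc k))
  monic-xPowMinusOne k = monic (coeff-monomial k (+ 1)) λ { (suc i) (s≤s h) → degreeBelow-monomial k (+ 1) i h }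

  xPowMinusOne-+ : ∀ a c → xPowMinusOne (a + c) ≈ (x^ c ⊗ xPowMinusOne a) ⊕ xPowMinusOne c
  xPowMinusOne-+ a c = begin
    xPowMinusOne (a + c)                             ≈⟨ xPowMinusOne≈ (a + c) ⟩
    x^ (a + c) ⊕ neg one                             ≈⟨ ⊕-cong (x^-+ a c) ≈-refl ⟩
    (x^ a ⊗ x^ c) ⊕ neg one                          ≈⟨ regroup (x^ a) (x^ c) ⟩
    (x^ c ⊗ (x^ a ⊕ neg one)) ⊕ (x^ c ⊕ neg one)     ≈⟨ ⊕-cong (⊗-congʳ (x^ c) (≈-sym (xPowMinusOne≈ a))) (≈-sym (xPowMinusOne≈ c)) ⟩
    (x^ c ⊗ xPowMinusOne a) ⊕ xPowMinusOne c         ∎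
    where
    open ≈-Reasoning
    regroup : ∀ A C → ((A ⊗ C) ⊕ neg one) ≈ ((C ⊗ (A ⊕ neg one)) ⊕ (C ⊕ neg one))
    regroup = solve-∀ ℤ[x]-solver

  x^≈one⊕xPowMinusOne : ∀ n → x^ n ≈ one ⊕ xPowMinusOne n
  x^≈one⊕xPowMinusOne n = ≈-trans (add-subtract-one (x^ n)) (⊕-cong ≈-refl (≈-sym (xPowMinusOne≈ n)))
    where
    add-subtract-one : ∀ X → X ≈ (one ⊕ (X ⊕ neg one))
    add-subtract-one = solve-∀ ℤ[x]-solver

  geometric : ℕ → ℕ → Poly
  geometric g zero = []
  geometric g (suc k) = one ⊕ (x^ g ⊗ geometric g k)

  xPowMinusOne-* : ∀ g k → xPowMinusOne (k * g) ≈ xPowMinusOne g ⊗ geometric g k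
  xPowMinusOne-* g zero = ≈-sym (⊗-zeroʳ (xPowMinusOne g))
  xPowMinusOne-* g (suc k) = begin
    xPowMinusOne (g + k * g)                                    ≈⟨ xPowMinusOne-+ g (k * g) ⟩
    (x^ (k * g) ⊗ G) ⊕ xPowMinusOne (k * g)                      ≈⟨ ⊕-cong (⊗-congˡ G (≈-trans (x^≈one⊕xPowMinusOne (k * g)) (⊕-cong ≈-refl ih))) ih ⟩
    ((one ⊕ (G ⊗ geometric g k)) ⊗ G) ⊕ (G ⊗ geometric g k)     ≈⟨ regroup G (geometric g k) ⟩
    G ⊗ (one ⊕ ((one ⊕ G) ⊗ geometric g k))                     ≈⟨ ⊗-congʳ G (⊕-cong ≈-refl (⊗-congˡ (geometric g k) (≈-sym (x^≈one⊕xPowMinusOne g)))) ⟩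
    G ⊗ geometric g (suc k)                                     ∎
    where
    open ≈-Reasoning
    G = xPowMinusOne g
    ih : xPowMinusOne (k * g) ≈ G ⊗ geometric g k
    ih = xPowMinusOne-* g k
    regroup : ∀ P G → (((one ⊕ (P ⊗ G)) ⊗ P) ⊕ (P ⊗ G)) ≈ (P ⊗ (one ⊕ ((one ⊕ P) ⊗ G)))
    regroup = solve-∀ ℤ[x]-solver

  -- Each of the k terms of the geometric sum is 1 modulo x^g − 1.
  geometric-mod : ∀ g k → Σ Poly λ H → geometric g k ≈ (H ⊗ xPowMinusOne g) ⊕ [ + k ]ₚ
  geometric-mod g zero = [] , ≈-sym shift-[]
  geometric-mod g (suc k) with geometric-mod g k
  ... | H , geo≈ = ((one ⊕ G) ⊗ H) ⊕ [ + k ]ₚ , (begin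
    one ⊕ (x^ g ⊗ geometric g k)                             ≈⟨ ⊕-cong ≈-refl (⊗-cong (x^≈one⊕xPowMinusOne g) geo≈) ⟩
    one ⊕ ((one ⊕ G) ⊗ ((H ⊗ G) ⊕ [ + k ]ₚ))                 ≈⟨ regroup G H [ + k ]ₚ ⟩
    ((((one ⊕ G) ⊗ H) ⊕ [ + k ]ₚ) ⊗ G) ⊕ (one ⊕ [ + k ]ₚ)    ≡⟨⟩
    ((((one ⊕ G) ⊗ H) ⊕ [ + k ]ₚ) ⊗ G) ⊕ [ + suc k ]ₚ         ∎)
    where
    open ≈-Reasoning
    G = xPowMinusOne g
    regroup : ∀ P H K → (one ⊕ ((one ⊕ P) ⊗ ((H ⊗ P) ⊕ K))) ≈ (((((one ⊕ P) ⊗ H) ⊕ K) ⊗ P) ⊕ (one ⊕ K))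
    regroup = solve-∀ ℤ[x]-solver

  record Bezout (a b : ℕ) : Set where
    constructor bezout
    field
      g : ℕ
      g∣a : g ∣ a
      g∣b : g ∣ b
      U V : Poly
      combination : (U ⊗ xPowMinusOne a) ⊕ (V ⊗ xPowMinusOne b) ≈ xPowMinusOne g

  bezout-sym : ∀ {a b} → Bezout a b → Bezout b a
  bezout-sym {a} {b} (bezout g g∣a g∣b U V comb) =
    bezout g g∣b g∣a V U (≈-trans (⊕-comm (V ⊗ xPowMinusOne b) (U ⊗ xPowMinusOne a)) comb)

  bezout-0 : ∀ b → Bezout 0 b
  bezout-0 b = bezout b (b ∣0) ∣-refl [] one (⊗-identityˡ (xPowMinusOne b))

  -- Subtractive Euclid: x^(a + c) − 1 ≡ x^c − 1 modulo x^a − 1.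
  bezout-+ : ∀ {a c} → Bezout a c → Bezout a (a + c)
  bezout-+ {a} {c} (bezout g g∣a g∣c U V comb) =
    bezout g g∣a (∣m∣n⇒∣m+n g∣a g∣c) (U ⊕ neg (V ⊗ x^ c)) V (begin
      ((U ⊕ neg (V ⊗ x^ c)) ⊗ A) ⊕ (V ⊗ xPowMinusOne (a + c))    ≈⟨ ⊕-cong ≈-refl (⊗-congʳ V (xPowMinusOne-+ a c)) ⟩
      ((U ⊕ neg (V ⊗ x^ c)) ⊗ A) ⊕ (V ⊗ ((x^ c ⊗ A) ⊕ C))        ≈⟨ cancel U V (x^ c) A C ⟩
      (U ⊗ A) ⊕ (V ⊗ C)                                         ≈⟨ comb ⟩
      xPowMinusOne g                                            ∎)
    where
    open ≈-Reasoning
    A = xPowMinusOne a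
    C = xPowMinusOne c
    cancel : ∀ U V X A C → ((((U ⊕ neg (V ⊗ X)) ⊗ A) ⊕ (V ⊗ ((X ⊗ A) ⊕ C)))) ≈ ((U ⊗ A) ⊕ (V ⊗ C))
    cancel = solve-∀ ℤ[x]-solver

  euclid-step-size : ∀ a b {n} → suc a + suc b ≤ suc n → suc a + (b ∸ a) ≤ n
  euclid-step-size a b {n} h = begin
    suc a + (b ∸ a)   ≤⟨ ℕP.+-monoʳ-≤ (suc a) (ℕP.m∸n≤m b a) ⟩
    suc a + b         ≡⟨ ℕP.+-suc a b ⟨
    a + suc b         ≤⟨ ℕP.≤-pred h ⟩
    n                 ∎
    where open ℕP.≤-Reasoning

  bezout-bounded : ∀ n a b → a + b ≤ n → Bezout a b
  bezout-bounded n zero b _ = bezout-0 b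
  bezout-bounded n (suc a) zero _ = bezout-sym (bezout-0 (suc a))
  bezout-bounded (suc n) (suc a) (suc b) size with suc a ≤? suc b
  ... | yes a≤b = subst (Bezout (suc a)) (ℕP.m+[n∸m]≡n a≤b) (bezout-+ (bezout-bounded n (suc a) (b ∸ a) (euclid-step-size a b size)))
  ... | no a≰b = bezout-sym (subst (Bezout (suc b)) (ℕP.m+[n∸m]≡n (ℕP.<⇒≤ (ℕP.≰⇒> a≰b)))
                   (bezout-+ (bezout-bounded n (suc b) (a ∸ b) (euclid-step-size b a (subst (_≤ suc n) (ℕP.+-comm (suc a) (suc b)) size)))))

  bezout-xPowMinusOne : ∀ a b → Bezout a b
  bezout-xPowMinusOne a b = bezout-bounded (a + b) a b ℕP.≤-refl

  -- Divisibility and coprimality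

  ∣ₚ-refl : ∀ A → A ∣ₚ A
  ∣ₚ-refl A = one , ≈-sym (⊗-identityˡ A)

  one-∣ₚ : ∀ A → one ∣ₚ A
  one-∣ₚ A = A , ≈-sym (⊗-identityʳ A)

  ∣ₚ-trans : ∀ {A B C} → A ∣ₚ B → B ∣ₚ C → A ∣ₚ C
  ∣ₚ-trans {A} (Q₁ , B≈Q₁A) (Q₂ , C≈Q₂B) = Q₂ ⊗ Q₁ , ≈-trans C≈Q₂B (≈-trans (⊗-congʳ Q₂ B≈Q₁A) (≈-sym (⊗-assoc Q₂ Q₁ A)))

  ∣ₚ-respʳ-≈ : ∀ {A B B′} → B ≈ B′ → A ∣ₚ B → A ∣ₚ B′
  ∣ₚ-respʳ-≈ B≈B′ (Q , B≈QA) = Q , ≈-trans (≈-sym B≈B′) B≈QA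

  ∣ₚ-respˡ-≈ : ∀ {A A′ B} → A ≈ A′ → A ∣ₚ B → A′ ∣ₚ B
  ∣ₚ-respˡ-≈ A≈A′ (Q , B≈QA) = Q , ≈-trans B≈QA (⊗-congʳ Q A≈A′)

  ⊗-∣ₚ-mono : ∀ {A B C D} → A ∣ₚ B → C ∣ₚ D → A ⊗ C ∣ₚ B ⊗ D
  ⊗-∣ₚ-mono {A} {C = C} (Q₁ , B≈Q₁A) (Q₂ , D≈Q₂C) = Q₁ ⊗ Q₂ , ≈-trans (⊗-cong B≈Q₁A D≈Q₂C) (regroup Q₁ Q₂ A C)
    where
    regroup : ∀ Q₁ Q₂ A C → ((Q₁ ⊗ A) ⊗ (Q₂ ⊗ C)) ≈ ((Q₁ ⊗ Q₂) ⊗ (A ⊗ C))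
    regroup = solve-∀ ℤ[x]-solver

  product<-∣ₚ-filter : ∀ {P Q : ℕ → Set} (P? : Decidable P) (Q? : Decidable Q) (F : ℕ → Poly) N → (∀ e → e < N → P e → Q e) →
                       product< P? F N ∣ₚ product< Q? F N
  product<-∣ₚ-filter P? Q? F zero _ = ∣ₚ-refl one
  product<-∣ₚ-filter P? Q? F (suc N) P⇒Q =
    ⊗-∣ₚ-mono (product<-∣ₚ-filter P? Q? F N λ e e<N → P⇒Q e (ℕP.m≤n⇒m≤1+n e<N)) last
    where
    last : (if does (P? N) then F N else one) ∣ₚ (if does (Q? N) then F N else one)
    last with P? N | Q? N
    ... | yes p | yes _ = ∣ₚ-refl (F N)
    ... | yes p | no ¬q = ⊥-elim (¬q (P⇒Q N ℕP.≤-refl p))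
    ... | no _ | _ = one-∣ₚ _

  product<-∣ₚ-≤ : ∀ {P : ℕ → Set} (P? : Decidable P) (F : ℕ → Poly) {N M} → N ≤ M → product< P? F N ∣ₚ product< P? F M
  product<-∣ₚ-≤ P? F {N} {zero} z≤n = ∣ₚ-refl one
  product<-∣ₚ-≤ P? F {N} {suc M} N≤M with N ℕ.≟ suc M
  ... | yes refl = ∣ₚ-refl _
  ... | no N≢M = ∣ₚ-trans (product<-∣ₚ-≤ P? F (ℕP.≤-pred (ℕP.≤∧≢⇒< N≤M N≢M)))
                          (last , ⊗-comm (product< P? F M) last)
    where
    last = if does (P? M) then F M else one

  monic-product< : ∀ {P : ℕ → Set} (P? : Decidable P) (F : ℕ → Poly) (deg : ℕ → ℕ) N → (∀ e → e < N → P e → Monic (deg e) (F e)) →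
                   Monic (Σ< N λ e → if does (P? e) then deg e else 0) (product< P? F N)
  monic-product< P? F deg zero _ = monic-one
  monic-product< P? F deg (suc N) monic-F = monic-⊗ (monic-product< P? F deg N λ e e<N → monic-F e (ℕP.m≤n⇒m≤1+n e<N)) last
    where
    last : Monic (if does (P? N) then deg N else 0) (if does (P? N) then F N else one)
    last with P? N
    ... | yes p = monic-F N ℕP.≤-refl p
    ... | no _ = monic-one

  -- Coprimality over ℚ, witnessed by an integer combination equal to a nonzero constant
  record Coprime (A B : Poly) : Set where
    constructor coprime
    field
      X Y : Poly
      c : ℤ
      c≢0 : ¬ c ≡ + 0
      combination : (X ⊗ A) ⊕ (Y ⊗ B) ≈ [ c ]ₚ

  coprime-sym : ∀ {A B} → Coprime A B → Coprime B A
  coprime-sym {A} {B} (coprime X Y c c≢0 comb) = coprime Y X c c≢0 (≈-trans (⊕-comm (Y ⊗ B) (X ⊗ A)) comb)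

  coprime-one : ∀ A → Coprime A one
  coprime-one A = coprime [] one (+ 1) (λ ()) (⊗-identityˡ one)

  coprime-⊗ : ∀ {A B C} → Coprime A B → Coprime A C → Coprime A (B ⊗ C)
  coprime-⊗ {A} {B} {C} (coprime X₁ Y₁ c₁ c₁≢0 comb₁) (coprime X₂ Y₂ c₂ c₂≢0 comb₂) =
    coprime (((X₁ ⊗ X₂) ⊗ A) ⊕ ((X₁ ⊗ (Y₂ ⊗ C)) ⊕ (Y₁ ⊗ (B ⊗ X₂)))) (Y₁ ⊗ Y₂) (c₁ ℤ.* c₂) c₁c₂≢0
      (≈-trans (≈-sym (expand X₁ Y₁ X₂ Y₂ A B C)) (≈-trans (⊗-cong comb₁ comb₂) constants))
    where
    constants : [ c₁ ]ₚ ⊗ [ c₂ ]ₚ ≈ [ c₁ ℤ.* c₂ ]ₚ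
    constants = ∷-cong (ℤP.+-identityʳ _) ≈-refl
    expand : ∀ X₁ Y₁ X₂ Y₂ A B C → (((X₁ ⊗ A) ⊕ (Y₁ ⊗ B)) ⊗ ((X₂ ⊗ A) ⊕ (Y₂ ⊗ C)))
             ≈ (((((X₁ ⊗ X₂) ⊗ A) ⊕ ((X₁ ⊗ (Y₂ ⊗ C)) ⊕ (Y₁ ⊗ (B ⊗ X₂)))) ⊗ A) ⊕ ((Y₁ ⊗ Y₂) ⊗ (B ⊗ C)))
    expand = solve-∀ ℤ[x]-solver
    c₁c₂≢0 : ¬ c₁ ℤ.* c₂ ≡ + 0
    c₁c₂≢0 c₁c₂≡0 with ℤP.i*j≡0⇒i≡0∨j≡0 c₁ c₁c₂≡0
    ... | inj₁ c₁≡0 = c₁≢0 c₁≡0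
    ... | inj₂ c₂≡0 = c₂≢0 c₂≡0

  coprime-product< : ∀ A {P : ℕ → Set} (P? : Decidable P) F N → (∀ e → e < N → P e → Coprime A (F e)) →
                     Coprime A (product< P? F N)
  coprime-product< A P? F zero _ = coprime-one A
  coprime-product< A P? F (suc N) coprime-F =
    coprime-⊗ (coprime-product< A P? F N λ e e<N → coprime-F e (ℕP.m≤n⇒m≤1+n e<N)) last
    where
    last : Coprime A (if does (P? N) then F N else one)
    last with P? N
    ... | yes p = coprime-F N ℕP.≤-refl p
    ... | no _ = coprime-one A

  -- The product rest of the earlier factors is coprime to F N, so F N ∣ T = Q · rest gives
  -- c Q = (X Q + Y (T / F N)) · F N, hence F N ∣ Q because F N is monic.
  product<-∣ₚ : ∀ T {P : ℕ → Set} (P? : Decidable P) F N →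
    (∀ e → e < N → P e → Σ ℕ λ D → Monic D (F e)) →
    (∀ e → e < N → P e → F e ∣ₚ T) →
    (∀ e e′ → e < N → e′ < N → P e → P e′ → ¬ e ≡ e′ → Coprime (F e) (F e′)) →
    product< P? F N ∣ₚ T
  product<-∣ₚ T P? F zero _ _ _ = one-∣ₚ T
  product<-∣ₚ T P? F (suc N) monic-F F∣T pairwise
    with product<-∣ₚ T P? F N (λ e l → monic-F e (below l)) (λ e l → F∣T e (below l))
                               (λ e e′ l l′ → pairwise e e′ (below l) (below l′))
    where
    below : ∀ {e} → e < N → e < suc N
    below = ℕP.m≤n⇒m≤1+n
  ... | rest∣T with P? N
  ...   | no _ = ∣ₚ-respˡ-≈ (≈-sym (⊗-identityʳ (product< P? F N))) rest∣T
  ...   | yes p = Q′ , (begin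
    T                                ≈⟨ T≈Q·rest ⟩
    Q ⊗ rest                         ≈⟨ ⊗-congˡ rest Q≈Q′F ⟩
    (Q′ ⊗ F N) ⊗ rest                ≈⟨ ⊗-assoc Q′ (F N) rest ⟩
    Q′ ⊗ (F N ⊗ rest)                ≈⟨ ⊗-congʳ Q′ (⊗-comm (F N) rest) ⟩
    Q′ ⊗ (rest ⊗ F N)                ∎)
    where
    open ≈-Reasoning
    rest = product< P? F N
    Q = proj₁ rest∣T
    T≈Q·rest : T ≈ Q ⊗ rest
    T≈Q·rest = proj₂ rest∣T
    open Coprime (coprime-product< (F N) P? F N λ e e<N pe →
                    pairwise N e ℕP.≤-refl (ℕP.m≤n⇒m≤1+n e<N) p pe λ N≡e → ℕP.<-irrefl (sym N≡e) e<N)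
    T/FN = proj₁ (F∣T N ℕP.≤-refl p)
    cQ≈ : [ c ]ₚ ⊗ Q ≈ ((X ⊗ Q) ⊕ (Y ⊗ T/FN)) ⊗ F N
    cQ≈ = begin
      [ c ]ₚ ⊗ Q                                   ≈⟨ ⊗-congˡ Q (≈-sym combination) ⟩
      ((X ⊗ F N) ⊕ (Y ⊗ rest)) ⊗ Q                 ≈⟨ distribute X (F N) Y rest Q ⟩
      ((X ⊗ Q) ⊗ F N) ⊕ (Y ⊗ (Q ⊗ rest))           ≈⟨ ⊕-cong ≈-refl (⊗-congʳ Y (≈-trans (≈-sym T≈Q·rest) (proj₂ (F∣T N ℕP.≤-refl p)))) ⟩
      ((X ⊗ Q) ⊗ F N) ⊕ (Y ⊗ (T/FN ⊗ F N))         ≈⟨ collect X Q (F N) Y T/FN ⟩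
      ((X ⊗ Q) ⊕ (Y ⊗ T/FN)) ⊗ F N                 ∎
      where
      distribute : ∀ X F Y P Q → ((((X ⊗ F) ⊕ (Y ⊗ P))) ⊗ Q) ≈ (((X ⊗ Q) ⊗ F) ⊕ (Y ⊗ (Q ⊗ P)))
      distribute = solve-∀ ℤ[x]-solver
      collect : ∀ X Q F Y R → (((X ⊗ Q) ⊗ F) ⊕ (Y ⊗ (R ⊗ F))) ≈ (((X ⊗ Q) ⊕ (Y ⊗ R)) ⊗ F)
      collect = solve-∀ ℤ[x]-solver
    FN∣Q : F N ∣ₚ Q
    FN∣Q = monic-∣-cancel-constant c Q (proj₂ (monic-F N ℕP.≤-refl p)) c≢0 ((X ⊗ Q) ⊕ (Y ⊗ T/FN) , cQ≈)
    Q′ = proj₁ FN∣Q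
    Q≈Q′F : Q ≈ Q′ ⊗ F N
    Q≈Q′F = proj₂ FN∣Q

  -- Gauss's formula ∑_{e ∣ d} φ(e) = d

  indicator : ∀ {A : Set} → Dec A → ℕ
  indicator (yes _) = 1
  indicator (no _) = 0

  indicator-yes : ∀ {A : Set} (a? : Dec A) → A → indicator a? ≡ 1
  indicator-yes (yes _) _ = refl
  indicator-yes (no ¬a) a = ⊥-elim (¬a a)

  indicator-no : ∀ {A : Set} (a? : Dec A) → ¬ A → indicator a? ≡ 0
  indicator-no (yes a) ¬a = ⊥-elim (¬a a)
  indicator-no (no _) _ = refl

  Σ<-cong : ∀ N {f g : ℕ → ℕ} → (∀ i → i < N → f i ≡ g i) → Σ< N f ≡ Σ< N g
  Σ<-cong zero _ = refl
  Σ<-cong (suc N) f≗g = cong₂ _+_ (Σ<-cong N λ i i<N → f≗g i (ℕP.m≤n⇒m≤1+n i<N)) (f≗g N ℕP.≤-refl)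

  Σ<-zero : ∀ N {f : ℕ → ℕ} → (∀ i → i < N → f i ≡ 0) → Σ< N f ≡ 0
  Σ<-zero zero _ = refl
  Σ<-zero (suc N) f≗0 = cong₂ _+_ (Σ<-zero N λ i i<N → f≗0 i (ℕP.m≤n⇒m≤1+n i<N)) (f≗0 N ℕP.≤-refl)

  Σ<-+ : ∀ N (f g : ℕ → ℕ) → Σ< N (λ i → f i + g i) ≡ Σ< N f + Σ< N g
  Σ<-+ zero f g = refl
  Σ<-+ (suc N) f g = trans (cong (_+ (f N + g N)) (Σ<-+ N f g)) (interchange (Σ< N f) (Σ< N g) (f N) (g N))
    where
    interchange : ∀ a b c d → (a + b) + (c + d) ≡ (a + c) + (b + d)
    interchange = solve-∀ℕ

  Σ<-split : ∀ a b (f : ℕ → ℕ) → Σ< (a + b) f ≡ Σ< a f + Σ< b (λ i → f (a + i))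
  Σ<-split a zero f = trans (cong (λ n → Σ< n f) (ℕP.+-identityʳ a)) (sym (ℕP.+-identityʳ _))
  Σ<-split a (suc b) f = begin
    Σ< (a + suc b) f                                        ≡⟨ cong (λ n → Σ< n f) (ℕP.+-suc a b) ⟩
    Σ< (a + b) f + f (a + b)                                ≡⟨ cong (_+ f (a + b)) (Σ<-split a b f) ⟩
    Σ< a f + Σ< b (λ i → f (a + i)) + f (a + b)             ≡⟨ ℕP.+-assoc (Σ< a f) _ _ ⟩
    Σ< a f + Σ< (suc b) (λ i → f (a + i))                   ∎
    where open ≡-Reasoning

  Σ<-swap : ∀ M N (F : ℕ → ℕ → ℕ) → Σ< M (λ e → Σ< N (λ j → F j e)) ≡ Σ< N (λ j → Σ< M (F j))
  Σ<-swap zero N F = sym (Σ<-zero N λ _ _ → refl)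
  Σ<-swap (suc M) N F =
    trans (cong (_+ Σ< N (λ j → F j M)) (Σ<-swap M N F)) (sym (Σ<-+ N (λ j → Σ< M (F j)) (λ j → F j M)))

  Σ<-1 : ∀ N → Σ< N (λ _ → 1) ≡ N
  Σ<-1 zero = refl
  Σ<-1 (suc N) = trans (cong (_+ 1) (Σ<-1 N)) (ℕP.+-comm N 1)

  Σ<-indicator-unique : ∀ M {P : ℕ → Set} (P? : Decidable P) e₀ → e₀ < M → P e₀ → (∀ e → e < M → P e → e ≡ e₀) →
                        Σ< M (indicator ∘ P?) ≡ 1
  Σ<-indicator-unique (suc M) P? e₀ e₀<M pe₀ unique with e₀ ℕ.≟ M
  ... | yes refl = cong₂ _+_ (Σ<-zero M λ i i<M → indicator-no (P? i) λ pi → ℕP.<-irrefl (unique i (ℕP.m≤n⇒m≤1+n i<M) pi) i<M)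
                             (indicator-yes (P? M) pe₀)
  ... | no e₀≢M = cong₂ _+_ (Σ<-indicator-unique M P? e₀ (ℕP.≤∧≢⇒< (ℕP.≤-pred e₀<M) e₀≢M) pe₀
                               λ e e<M pe → unique e (ℕP.m≤n⇒m≤1+n e<M) pe)
                             (indicator-no (P? M) λ pM → e₀≢M (sym (unique M ℕP.≤-refl pM)))

  length-filter-map-upTo : ∀ {P : ℕ → Set} (P? : Decidable P) (f : ℕ → ℕ) N →
                           length (filter P? (map f (upTo N))) ≡ Σ< N (λ j → indicator (P? (f j)))
  length-filter-map-upTo P? f zero = refl
  length-filter-map-upTo P? f (suc N) =
    subst (λ ns → length (filter P? (map f ns)) ≡ Σ< (suc N) (λ j → indicator (P? (f j)))) (List.upTo-∷ʳ N) (begin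
    length (filter P? (map f (upTo N ++ N ∷ [])))                    ≡⟨ cong (λ xs → length (filter P? xs)) (List.map-++ f (upTo N) (N ∷ [])) ⟩
    length (filter P? (map f (upTo N) ++ f N ∷ []))                  ≡⟨ cong length (List.filter-++ P? (map f (upTo N)) (f N ∷ [])) ⟩
    length (filter P? (map f (upTo N)) ++ filter P? (f N ∷ []))      ≡⟨ List.length-++ (filter P? (map f (upTo N))) ⟩
    length (filter P? (map f (upTo N))) + length (filter P? (f N ∷ []))
                                                                     ≡⟨ cong₂ _+_ (length-filter-map-upTo P? f N) last ⟩
    Σ< (suc N) (λ j → indicator (P? (f j)))                   ∎)
    where
    open ≡-Reasoning
    last : length (filter P? (f N ∷ [])) ≡ indicator (P? (f N))
    last with P? (f N)
    ... | yes _ = refl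
    ... | no _ = refl

  Σ<-multiples : ∀ q e {P : ℕ → Set} (P? : Decidable P) → (∀ x → P x → suc q ∣ x) →
                 Σ< (suc q * e) (λ j → indicator (P? (suc j))) ≡ Σ< e (λ i → indicator (P? (suc q * suc i)))
  Σ<-multiples q zero P? _ = cong (λ n → Σ< n (λ j → indicator (P? (suc j)))) (ℕP.*-zeroʳ q)
  Σ<-multiples q (suc e) P? only-multiples = begin
    Σ< (Q * suc e) f                                   ≡⟨ cong (λ n → Σ< n f) (trans (ℕP.*-suc Q e) (ℕP.+-comm Q (Q * e))) ⟩
    Σ< (Q * e + Q) f                                   ≡⟨ Σ<-split (Q * e) Q f ⟩
    Σ< (Q * e) f + Σ< Q (λ i → f (Q * e + i))          ≡⟨ cong₂ _+_ (Σ<-multiples q e P? only-multiples) block ⟩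
    Σ< e (λ i → indicator (P? (Q * suc i))) + indicator (P? (Q * suc e)) ∎
    where
    open ≡-Reasoning
    Q = suc q
    f = λ j → indicator (P? (suc j))
    not-multiple : ∀ i → i < q → ¬ Q ∣ suc (Q * e + i)
    not-multiple i i<q Q∣ = ℕP.<-irrefl refl (ℕP.≤-<-trans (∣⇒≤ Q∣suc-i) (s≤s i<q))
      where
      Q∣suc-i : Q ∣ suc i
      Q∣suc-i = ∣m+n∣m⇒∣n (subst (Q ∣_) (sym (ℕP.+-suc (Q * e) i)) Q∣) (divides e (ℕP.*-comm Q e))
    block : Σ< Q (λ i → f (Q * e + i)) ≡ indicator (P? (Q * suc e))
    block = cong₂ _+_ (Σ<-zero q λ i i<q → indicator-no (P? _) λ pi → not-multiple i i<q (only-multiples _ pi))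
                      (cong (indicator ∘ P?) (trans (sym (ℕP.+-suc (Q * e) q)) (trans (ℕP.+-comm (Q * e) Q) (sym (ℕP.*-suc Q e)))))

  indicator-⇔ : ∀ {A B : Set} (a? : Dec A) (b? : Dec B) → (A → B) → (B → A) → indicator a? ≡ indicator b?
  indicator-⇔ (yes a) b? to from = sym (indicator-yes b? (to a))
  indicator-⇔ (no ¬a) b? to from = sym (indicator-no b? (¬a ∘ from))

  totient≡Σ< : ∀ n → totient n ≡ Σ< n (λ j → indicator (gcd (suc j) n ℕ.≟ 1))
  totient≡Σ< n = length-filter-map-upTo (λ j → gcd j n ℕ.≟ 1) suc n

  -- the number of x ∈ [1, d] with gcd x d = d / e
  gcdClass : ℕ → ℕ → ℕ
  gcdClass d e = Σ< d (λ j → indicator (gcd (suc j) d * e ℕ.≟ d))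

  -- For d = q e: gcd x d = q forces x = q y, and then gcd (q y) (q e) = q · gcd y e.
  gcdClass-size : ∀ d → 1 ≤ d → ∀ e → gcdClass d e ≡ (if does (e ∣? d) then totient e else 0)
  gcdClass-size d 1≤d e with e ∣? d
  ... | no e∤d = Σ<-zero d λ j _ → indicator-no (gcd (suc j) d * e ℕ.≟ d) λ eq → e∤d (divides (gcd (suc j) d) (sym eq))
  ... | yes (divides zero d≡0) = ⊥-elim (ℕP.<-irrefl (sym d≡0) 1≤d)
  ... | yes (divides (suc q) d≡qe) with e
  ...   | zero = ⊥-elim (ℕP.<-irrefl (sym (trans d≡qe (ℕP.*-zeroʳ (suc q)))) 1≤d)
  ...   | suc e′ = begin
    Σ< d (λ j → indicator (class? (suc j)))                      ≡⟨ cong (λ n → Σ< n (λ j → indicator (class? (suc j)))) d≡qe ⟩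
    Σ< (Q * E) (λ j → indicator (class? (suc j)))                ≡⟨ Σ<-multiples q E class? multiple ⟩
    Σ< E (λ i → indicator (class? (Q * suc i)))                  ≡⟨ Σ<-cong E (λ i _ → indicator-⇔ (class? (Q * suc i)) (gcd (suc i) E ℕ.≟ 1) (to i) (from i)) ⟩
    Σ< E (λ i → indicator (gcd (suc i) E ℕ.≟ 1))                 ≡⟨ totient≡Σ< E ⟨
    totient E                                                    ∎
    where
    open ≡-Reasoning
    Q = suc q
    E = suc e′
    class? : ∀ x → Dec (gcd x d * E ≡ d)
    class? x = gcd x d * E ℕ.≟ d
    gcd≡Q : ∀ x → gcd x d * E ≡ d → gcd x d ≡ Q
    gcd≡Q x eq = ℕP.*-cancelʳ-≡ (gcd x d) Q E (trans eq d≡qe)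
    multiple : ∀ x → gcd x d * E ≡ d → Q ∣ x
    multiple x eq = subst (_∣ x) (gcd≡Q x eq) (gcd[m,n]∣m x d)
    gcd-scaled : ∀ y → gcd (Q * y) d ≡ Q * gcd y E
    gcd-scaled y = trans (cong (gcd (Q * y)) d≡qe) (sym (c*gcd[m,n]≡gcd[cm,cn] Q y E))
    to : ∀ i → gcd (Q * suc i) d * E ≡ d → gcd (suc i) E ≡ 1
    to i eq = ℕP.*-cancelˡ-≡ (gcd (suc i) E) 1 Q (trans (sym (gcd-scaled (suc i))) (trans (gcd≡Q (Q * suc i) eq) (sym (ℕP.*-identityʳ Q))))
    from : ∀ i → gcd (suc i) E ≡ 1 → gcd (Q * suc i) d * E ≡ d
    from i gcd≡1 = begin
      gcd (Q * suc i) d * E      ≡⟨ cong (_* E) (trans (gcd-scaled (suc i)) (cong (Q *_) gcd≡1)) ⟩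
      Q * 1 * E                  ≡⟨ cong (_* E) (ℕP.*-identityʳ Q) ⟩
      Q * E                      ≡⟨ d≡qe ⟨
      d                          ∎

  -- Every x ∈ [1, d] lies in exactly one class, the one with e = d / gcd x d.
  Σ<-gcdClass : ∀ d → Σ< (suc d) (gcdClass d) ≡ d
  Σ<-gcdClass d = begin
    Σ< (suc d) (λ e → Σ< d (λ j → indicator (class? (suc j) e)))    ≡⟨ Σ<-swap (suc d) d (λ j e → indicator (class? (suc j) e)) ⟩
    Σ< d (λ j → Σ< (suc d) (λ e → indicator (class? (suc j) e)))    ≡⟨ Σ<-cong d (λ j _ → one-class (suc j)) ⟩
    Σ< d (λ _ → 1)                                                  ≡⟨ Σ<-1 d ⟩
    d                                                               ∎
    where
    open ≡-Reasoning
    class? : ∀ x e → Dec (gcd x d * e ≡ d)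
    class? x e = gcd x d * e ℕ.≟ d
    one-class : ∀ x → .{{NonZero x}} → Σ< (suc d) (indicator ∘ class? x) ≡ 1
    one-class x = Σ<-indicator-unique (suc d) (class? x) cofactor (s≤s (subst (cofactor ≤_) (sym d≡cofactor·gcd) (ℕP.m≤m*n cofactor (gcd x d))))
                    (trans (ℕP.*-comm (gcd x d) cofactor) (sym d≡cofactor·gcd))
                    λ e _ eq → ℕP.*-cancelˡ-≡ e cofactor (gcd x d) (trans eq (trans d≡cofactor·gcd (ℕP.*-comm cofactor (gcd x d))))
      where
      instance
        gcd≢0 : NonZero (gcd x d)
        gcd≢0 = ℕ.≢-nonZero λ gcd≡0 → ℕ.≢-nonZero⁻¹ x (gcd[m,n]≡0⇒m≡0 gcd≡0)
      cofactor = _∣_.quotient (gcd[m,n]∣n x d)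
      d≡cofactor·gcd : d ≡ cofactor * gcd x d
      d≡cofactor·gcd = _∣_.equality (gcd[m,n]∣n x d)
      d≡gcd·cofactor : d ≡ gcd x d * cofactor
      d≡gcd·cofactor = trans d≡cofactor·gcd (ℕP.*-comm cofactor (gcd x d))

  gauss : ∀ d → 1 ≤ d → Σ< d (λ e → if does (e ∣? d) then totient e else 0) + totient d ≡ d
  gauss d 1≤d = begin
    Σ< d (λ e → if does (e ∣? d) then totient e else 0) + totient d
      ≡⟨ cong (_+_ (Σ< d (λ e → if does (e ∣? d) then totient e else 0))) last ⟨
    Σ< (suc d) (λ e → if does (e ∣? d) then totient e else 0)
      ≡⟨ Σ<-cong (suc d) (λ e _ → gcdClass-size d 1≤d e) ⟨
    Σ< (suc d) (gcdClass d)
      ≡⟨ Σ<-gcdClass d ⟩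
    d ∎
    where
    open ≡-Reasoning
    last : (if does (d ∣? d) then totient d else 0) ≡ totient d
    last rewrite dec-true (d ∣? d) ∣-refl = refl

  -- Exactness of the division defining Φ d

  record Exact (d : ℕ) : Set where
    constructor exact
    field
      Ψ-monic : Monic (psi d) (Ψ d)
      Φ⊗Ψ : Φ d ⊗ Ψ d ≈ xPowMinusOne d

  totient≤ : ∀ n → totient n ≤ n
  totient≤ n = subst (totient n ≤_) (trans (List.length-map suc (upTo n)) (List.length-upTo n))
                 (List.length-filter (λ j → gcd j n ℕ.≟ 1) (map suc (upTo n)))

  Φ-monic : ∀ d → Exact (suc d) → Monic (totient (suc d)) (Φ (suc d))
  Φ-monic d (exact Ψ-monic Φ⊗Ψ) = subst (λ k → Monic k (Φ (suc d))) (ℕP.m∸[m∸n]≡n (totient≤ (suc d)))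
    (proj₂ (monic-quotient (Φ (suc d)) Ψ-monic (monic-resp-≈ (≈-sym Φ⊗Ψ) (monic-xPowMinusOne d))))

  xPowMinusOne-∣ : ∀ {e d} → e ∣ d → xPowMinusOne e ∣ₚ xPowMinusOne d
  xPowMinusOne-∣ {e} (divides k refl) = geometric e k , ≈-trans (xPowMinusOne-* e k) (⊗-comm (xPowMinusOne e) (geometric e k))

  Φ-∣-xPowMinusOne : ∀ {e d} → Exact e → e ∣ d → Φ e ∣ₚ xPowMinusOne d
  Φ-∣-xPowMinusOne {e} (exact _ Φ⊗Ψ) e∣d = ∣ₚ-trans (Ψ e , ≈-trans (≈-sym Φ⊗Ψ) (⊗-comm (Φ e) (Ψ e))) (xPowMinusOne-∣ e∣d)

  product<-suc : ∀ {P : ℕ → Set} (P? : Decidable P) F N → P N → product< P? F (suc N) ≡ product< P? F N ⊗ F N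
  product<-suc P? F N pN rewrite dec-true (P? N) pN = refl

  -- x^g − 1 = ∏_{e ∣ g} Φ e, and every divisor of g is a proper divisor of a.
  xPowMinusOne-∣-Ψ : ∀ {g a} → Exact g → g ∣ a → g < a → xPowMinusOne g ∣ₚ Ψ a
  xPowMinusOne-∣-Ψ {g} {a} (exact _ Φ⊗Ψ) g∣a g<a =
    ∣ₚ-respʳ-≈ (≈-sym (Ψ≈product a)) (∣ₚ-respˡ-≈ (≈-sym x^g-1≈product)
      (∣ₚ-trans (product<-∣ₚ-filter (_∣? g) (_∣? a) Φ (suc g) λ _ _ e∣g → ∣-trans e∣g g∣a)
                (product<-∣ₚ-≤ (_∣? a) Φ g<a)))
    where
    x^g-1≈product : xPowMinusOne g ≈ product< (_∣? g) Φ (suc g)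
    x^g-1≈product = begin
      xPowMinusOne g                  ≈⟨ ≈-sym Φ⊗Ψ ⟩
      Φ g ⊗ Ψ g                       ≈⟨ ⊗-comm (Φ g) (Ψ g) ⟩
      Ψ g ⊗ Φ g                       ≈⟨ ⊗-congˡ (Φ g) (Ψ≈product g) ⟩
      product< (_∣? g) Φ g ⊗ Φ g      ≡⟨ product<-suc (_∣? g) Φ g ∣-refl ⟨
      product< (_∣? g) Φ (suc g)      ∎
      where open ≈-Reasoning

  -- With Ψ a = W (x^g − 1) and a = k g: Φ a W (x^g − 1) = x^a − 1 = (x^g − 1)(1 + x^g + ⋯ + x^(k−1)g),
  -- so Φ a W ≡ k modulo x^g − 1.
  Φ-coprime-xPowMinusOne : ∀ {a g} → Exact a → Exact g → g ∣ a → g < a → Coprime (Φ a) (xPowMinusOne g)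
  Φ-coprime-xPowMinusOne {g = zero} _ _ (divides k a≡0) 0<a = ⊥-elim (ℕP.<-irrefl (sym (trans a≡0 (ℕP.*-zeroʳ k))) 0<a)
  Φ-coprime-xPowMinusOne {a} {suc g} (exact _ Φ⊗Ψ) exact-g g∣a@(divides k a≡kg) g<a with geometric-mod (suc g) k
  ... | H , geometric≈ = coprime W (neg H) (+ k) k≢0 (begin
    (W ⊗ Φ a) ⊕ (neg H ⊗ G)          ≈⟨ rearrange W (Φ a) H G ⟩
    ((Φ a ⊗ W) ⊕ neg (H ⊗ G))        ≈⟨ ⊕-cong (≈-trans ΦW≈geometric geometric≈) ≈-refl ⟩
    ((H ⊗ G) ⊕ [ + k ]ₚ) ⊕ neg (H ⊗ G) ≈⟨ cancel (H ⊗ G) [ + k ]ₚ ⟩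
    [ + k ]ₚ                          ∎)
    where
    open ≈-Reasoning
    G = xPowMinusOne (suc g)
    W = proj₁ (xPowMinusOne-∣-Ψ exact-g g∣a g<a)
    Ψ≈WG : Ψ a ≈ W ⊗ G
    Ψ≈WG = proj₂ (xPowMinusOne-∣-Ψ exact-g g∣a g<a)
    ΦW≈geometric : Φ a ⊗ W ≈ geometric (suc g) k
    ΦW≈geometric = ⊗-cancelʳ-monic (Φ a ⊗ W) (geometric (suc g) k) (monic-xPowMinusOne g) (begin
      (Φ a ⊗ W) ⊗ G                ≈⟨ ⊗-assoc (Φ a) W G ⟩
      Φ a ⊗ (W ⊗ G)                ≈⟨ ⊗-congʳ (Φ a) Ψ≈WG ⟨
      Φ a ⊗ Ψ a                    ≈⟨ Φ⊗Ψ ⟩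
      xPowMinusOne a               ≡⟨ cong xPowMinusOne a≡kg ⟩
      xPowMinusOne (k * suc g)     ≈⟨ xPowMinusOne-* (suc g) k ⟩
      G ⊗ geometric (suc g) k      ≈⟨ ⊗-comm G (geometric (suc g) k) ⟩
      geometric (suc g) k ⊗ G      ∎)
    k≢0 : ¬ + k ≡ + 0
    k≢0 k≡0 = ℕP.<-irrefl (sym (trans a≡kg (cong (_* suc g) (ℤP.+-injective k≡0)))) (ℕP.<-trans (s≤s z≤n) g<a)
    rearrange : ∀ W F H G → ((W ⊗ F) ⊕ (neg H ⊗ G)) ≈ ((F ⊗ W) ⊕ neg (H ⊗ G))
    rearrange = solve-∀ ℤ[x]-solver
    cancel : ∀ A K → ((A ⊕ K) ⊕ neg A) ≈ K
    cancel = solve-∀ ℤ[x]-solver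

  -- x^g − 1 = U (x^a − 1) + V (x^b − 1) = U Ψ a · Φ a + V Ψ b · Φ b
  Φ-coprime-via-bezout : ∀ {a b} → Exact a → Exact b → (B : Bezout a b) → Coprime (Φ a) (xPowMinusOne (Bezout.g B)) →
                         Coprime (Φ a) (Φ b)
  Φ-coprime-via-bezout {a} {b} (exact _ Φ⊗Ψa) (exact _ Φ⊗Ψb) (bezout g _ _ U V comb) (coprime X Y c c≢0 combination) =
    coprime (X ⊕ (Y ⊗ (U ⊗ Ψ a))) (Y ⊗ (V ⊗ Ψ b)) c c≢0 (begin
      ((X ⊕ (Y ⊗ (U ⊗ Ψ a))) ⊗ Φ a) ⊕ ((Y ⊗ (V ⊗ Ψ b)) ⊗ Φ b)
        ≈⟨ regroup X Y U V (Φ a) (Ψ a) (Φ b) (Ψ b) ⟨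
      (X ⊗ Φ a) ⊕ (Y ⊗ ((U ⊗ (Φ a ⊗ Ψ a)) ⊕ (V ⊗ (Φ b ⊗ Ψ b))))
        ≈⟨ ⊕-cong ≈-refl (⊗-congʳ Y (≈-trans (⊕-cong (⊗-congʳ U Φ⊗Ψa) (⊗-congʳ V Φ⊗Ψb)) comb)) ⟩
      (X ⊗ Φ a) ⊕ (Y ⊗ xPowMinusOne g)
        ≈⟨ combination ⟩
      [ c ]ₚ ∎)
    where
    open ≈-Reasoning
    regroup : ∀ X Y U V Fa Pa Fb Pb → ((X ⊗ Fa) ⊕ (Y ⊗ ((U ⊗ (Fa ⊗ Pa)) ⊕ (V ⊗ (Fb ⊗ Pb)))))
              ≈ (((X ⊕ (Y ⊗ (U ⊗ Pa))) ⊗ Fa) ⊕ ((Y ⊗ (V ⊗ Pb)) ⊗ Fb))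
    regroup = solve-∀ ℤ[x]-solver

  -- The g of a Bezout relation divides a and b, so it is a proper divisor of a or of b.
  Φ-coprime : ∀ {a b} .{{_ : NonZero a}} .{{_ : NonZero b}} → (∀ {e} → e ≤ a ℕ.⊔ b → Exact e) → ¬ a ≡ b →
              Coprime (Φ a) (Φ b)
  Φ-coprime {a} {b} exact-below a≢b with bezout-xPowMinusOne a b
  ... | B@(bezout g g∣a g∣b _ _ _) with g ℕ.≟ a
  ...   | no g≢a = Φ-coprime-via-bezout exact-a exact-b B
                     (Φ-coprime-xPowMinusOne exact-a (exact-below g≤max) g∣a (ℕP.≤∧≢⇒< (∣⇒≤ g∣a) g≢a))
    where
    exact-a : Exact a
    exact-a = exact-below (ℕP.m≤m⊔n a b)
    exact-b : Exact b
    exact-b = exact-below (ℕP.m≤n⊔m a b)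
    g≤max : g ≤ a ℕ.⊔ b
    g≤max = ℕP.≤-trans (∣⇒≤ g∣a) (ℕP.m≤m⊔n a b)
  ...   | yes refl = coprime-sym (Φ-coprime-via-bezout exact-b exact-a (bezout-sym B)
                       (Φ-coprime-xPowMinusOne exact-b (exact-below (ℕP.m≤m⊔n g b)) g∣b g<b))
    where
    exact-a : Exact g
    exact-a = exact-below (ℕP.m≤m⊔n g b)
    exact-b : Exact b
    exact-b = exact-below (ℕP.m≤n⊔m g b)
    g<b : g < b
    g<b = ℕP.≤∧≢⇒< (∣⇒≤ g∣b) a≢b

  exact-step : ∀ d → (∀ {e} → e < d → Exact e) → Exact d
  exact-step zero _ = exact monic-one ≈-refl
  exact-step d@(suc d′) exact-below = exact Ψ-monic (begin
    Φ d ⊗ Ψ d                   ≈⟨ ⊗-congˡ (Ψ d) (monicQuot-correct (xPowMinusOne d) Q Ψ-monic x^d-1≈QΨ) ⟩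
    Q ⊗ Ψ d                     ≈⟨ x^d-1≈QΨ ⟨
    xPowMinusOne d              ∎)
    where
    open ≈-Reasoning
    pos : ∀ {e} → e ∣ d → NonZero e
    pos {zero} (divides k d≡0) = ⊥-elim (ℕ.≢-nonZero⁻¹ d (trans d≡0 (ℕP.*-zeroʳ k)))
    pos {suc e} _ = _
    monic-Φ : ∀ e → e < d → e ∣ d → Monic (totient e) (Φ e)
    monic-Φ zero _ 0∣d = ⊥-elim (ℕ.≢-nonZero⁻¹ 0 {{pos 0∣d}} refl)
    monic-Φ (suc e) e<d _ = Φ-monic e (exact-below e<d)
    pairwise : ∀ e e′ → e < d → e′ < d → e ∣ d → e′ ∣ d → ¬ e ≡ e′ → Coprime (Φ e) (Φ e′)
    pairwise e e′ e<d e′<d e∣d e′∣d = Φ-coprime {{pos e∣d}} {{pos e′∣d}} λ e″≤ → exact-below (ℕP.≤-<-trans e″≤ (ℕP.⊔-lub e<d e′<d))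
    product∣ : product< (_∣? d) Φ d ∣ₚ xPowMinusOne d
    product∣ = product<-∣ₚ (xPowMinusOne d) (_∣? d) Φ d (λ e e<d e∣d → totient e , monic-Φ e e<d e∣d)
                 (λ e e<d e∣d → Φ-∣-xPowMinusOne (exact-below e<d) e∣d) pairwise
    degree≡psi : Σ< d (λ e → if does (e ∣? d) then totient e else 0) ≡ psi d
    degree≡psi = trans (sym (ℕP.m+n∸n≡m _ (totient d))) (cong (_∸ totient d) (gauss d (s≤s z≤n)))
    Ψ-monic : Monic (psi d) (Ψ d)
    Ψ-monic = monic-resp-≈ (≈-sym (Ψ≈product d))
                (subst (λ D → Monic D (product< (_∣? d) Φ d)) degree≡psi (monic-product< (_∣? d) Φ totient d monic-Φ))
    Q = proj₁ product∣
    x^d-1≈QΨ : xPowMinusOne d ≈ Q ⊗ Ψ d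
    x^d-1≈QΨ = ≈-trans (proj₂ product∣) (⊗-congʳ Q (≈-sym (Ψ≈product d)))

  exactness : ∀ d → Exact d
  exactness = <-rec Exact exact-step

  -- Gaps in the support

  supportFrom-∷ : ∀ i c p → ¬ c ≡ + 0 → supportFrom i (c ∷ p) ≡ i ∷ supportFrom (suc i) p
  supportFrom-∷ i (+ zero) p c≢0 = ⊥-elim (c≢0 refl)
  supportFrom-∷ i (+ suc n) p _ = refl
  supportFrom-∷ i -[1+ n ] p _ = refl

  supportFrom-bounded : ∀ i p → All (i ≤_) (supportFrom i p)
  supportFrom-bounded i [] = []
  supportFrom-bounded i (c ∷ p) with c ℤ.≟ + 0
  ... | yes refl = All.map ℕP.<⇒≤ (supportFrom-bounded (suc i) p)
  ... | no c≢0 rewrite supportFrom-∷ i c p c≢0 = ℕP.≤-refl ∷ All.map ℕP.<⇒≤ (supportFrom-bounded (suc i) p)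

  supportFrom-sorted : ∀ i p → AllPairs _<_ (supportFrom i p)
  supportFrom-sorted i [] = []
  supportFrom-sorted i (c ∷ p) with c ℤ.≟ + 0
  ... | yes refl = supportFrom-sorted (suc i) p
  ... | no c≢0 rewrite supportFrom-∷ i c p c≢0 = supportFrom-bounded (suc i) p ∷ supportFrom-sorted (suc i) p

  ∈-supportFrom : ∀ i p j → ¬ coeff p j ≡ + 0 → i + j ∈ supportFrom i p
  ∈-supportFrom i [] j c≢0 = ⊥-elim (c≢0 refl)
  ∈-supportFrom i (c ∷ p) zero c≢0 rewrite supportFrom-∷ i c p c≢0 = here (ℕP.+-identityʳ i)
  ∈-supportFrom i (c ∷ p) (suc j) cj≢0 = subst (_∈ supportFrom i (c ∷ p)) (sym (ℕP.+-suc i j)) rest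
    where
    rest : suc i + j ∈ supportFrom i (c ∷ p)
    rest with c ℤ.≟ + 0
    ... | yes refl = ∈-supportFrom (suc i) p j cj≢0
    ... | no c≢0 rewrite supportFrom-∷ i c p c≢0 = there (∈-supportFrom (suc i) p j cj≢0)

  SupportIndex : ℕ → Poly → ℕ → Set
  SupportIndex i p z = Σ ℕ λ j → z ≡ i + j × ¬ coeff p j ≡ + 0

  supportIndex-∷ : ∀ {i z} a p → SupportIndex (suc i) p z → SupportIndex i (a ∷ p) z
  supportIndex-∷ {i} a p (j , z≡ , cj≢0) = suc j , trans z≡ (sym (ℕP.+-suc i j)) , cj≢0

  supportFrom-∈ : ∀ i p {z} → z ∈ supportFrom i p → SupportIndex i p z
  supportFrom-∈ i [] ()
  supportFrom-∈ i (c ∷ p) {z} z∈ with c ℤ.≟ + 0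
  ... | yes refl = supportIndex-∷ (+ 0) p (supportFrom-∈ (suc i) p z∈)
  ... | no c≢0 = head-or-tail (subst (z ∈_) (supportFrom-∷ i c p c≢0) z∈)
    where
    head-or-tail : z ∈ i ∷ supportFrom (suc i) p → SupportIndex i (c ∷ p) z
    head-or-tail (here z≡i) = 0 , trans z≡i (sym (ℕP.+-identityʳ i)) , c≢0
    head-or-tail (there z∈′) = supportIndex-∷ c p (supportFrom-∈ (suc i) p z∈′)

  sorted-head-≤ : ∀ {x xs L} → AllPairs _<_ (x ∷ xs) → Any (_≤ L) (x ∷ xs) → x ≤ L
  sorted-head-≤ _ (here x≤L) = x≤L
  sorted-head-≤ {x} {L = L} (x<xs ∷ _) (there y≤L) = ℕP.<⇒≤ (All.lookupWith {R = λ _ → x < L} ℕP.<-≤-trans x<xs y≤L)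

  -- If s has elements ≤ L and ≥ R but none strictly between, two consecutive elements straddle the gap.
  maxGapList-≥ : ∀ {L R} s → L < R → AllPairs _<_ s → Any (_≤ L) s → Any (R ≤_) s → All (λ z → z ≤ L ⊎ R ≤ z) s →
                 R ∸ L ≤ maxGapList s
  maxGapList-≥ (x ∷ []) L<R _ (here x≤L) (here R≤x) _ = ⊥-elim (ℕP.<-irrefl refl (ℕP.<-≤-trans L<R (ℕP.≤-trans R≤x x≤L)))
  maxGapList-≥ {L} {R} (x ∷ y ∷ s) L<R sorted@((x<y ∷ _) ∷ sorted′) left right (_ ∷ y-side ∷ outside) with y-side
  ... | inj₂ R≤y = ℕP.≤-trans (ℕP.∸-mono R≤y (sorted-head-≤ sorted left)) (ℕP.m≤m⊔n (y ∸ x) (maxGapList (y ∷ s)))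
  ... | inj₁ y≤L = ℕP.≤-trans (maxGapList-≥ (y ∷ s) L<R sorted′ (here y≤L) (drop-head right) (y-side ∷ outside))
                              (ℕP.m≤n⊔m (y ∸ x) (maxGapList (y ∷ s)))
    where
    drop-head : Any (R ≤_) (x ∷ y ∷ s) → Any (R ≤_) (y ∷ s)
    drop-head (here R≤x) = ⊥-elim (ℕP.<-irrefl refl (ℕP.<-≤-trans L<R (ℕP.≤-trans R≤x (ℕP.<⇒≤ (ℕP.<-≤-trans x<y y≤L)))))
    drop-head (there R≤) = R≤

  maxGap-≥ : ∀ p {L R b} → L < R → R ≤ b → ¬ coeff p L ≡ + 0 → ¬ coeff p b ≡ + 0 →
             (∀ i → L < i → i < R → coeff p i ≡ + 0) → R ∸ L ≤ maxGap p
  maxGap-≥ p {L} {R} {b} L<R R≤b cL≢0 cb≢0 gap =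
    maxGapList-≥ (support p) L<R (supportFrom-sorted 0 p)
      (Any.map (λ L≡z → ℕP.≤-reflexive (sym L≡z)) (∈-supportFrom 0 p L cL≢0))
      (Any.map (λ b≡z → subst (R ≤_) b≡z R≤b) (∈-supportFrom 0 p b cb≢0))
      (All.tabulate outside)
    where
    outside : ∀ {z} → z ∈ support p → z ≤ L ⊎ R ≤ z
    outside {z} z∈ with z ≤? L | R ≤? z | supportFrom-∈ 0 p z∈
    ... | yes z≤L | _ | _ = inj₁ z≤L
    ... | no _ | yes R≤z | _ = inj₂ R≤z
    ... | no z≰L | no R≰z | (j , refl , cz≢0) = ⊥-elim (cz≢0 (gap z (ℕP.≰⇒> z≰L) (ℕP.≰⇒> R≰z)))

  coeff-x^⊗-below : ∀ k F i → i < k → coeff (x^ k ⊗ F) i ≡ + 0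
  coeff-x^⊗-below k F i i<k = trans (sym (at (replicate-++ k F) i)) (padding k i i<k)
    where
    padding : ∀ k i → i < k → coeff (replicate k (+ 0) ++ F) i ≡ + 0
    padding (suc k) zero _ = refl
    padding (suc k) (suc i) (s≤s i<k) = padding k i i<k

  maxGap-Psi : ∀ n m .{{_ : NonZero m}} → m ∣ n → m < n → 2 * m ∸ psi n ≤ maxGap (Psi n)
  maxGap-Psi n m@(suc m′) m∣n m<n = subst (_≤ maxGap (Psi n)) (sym 2m∸D≡m∸[D∸m]) gap
    where
    D : ℕ
    D = psi n
    Ψ-monic : Monic D (Ψ n)
    Ψ-monic = Exact.Ψ-monic (exactness n)
    G∣Ψ : xPowMinusOne m ∣ₚ Ψ n
    G∣Ψ = xPowMinusOne-∣-Ψ (exactness m) m∣n m<n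
    F : Poly
    F = proj₁ G∣Ψ
    Ψ≈FG : Ψ n ≈ F ⊗ xPowMinusOne m
    Ψ≈FG = proj₂ G∣Ψ
    F-quotient : m ≤ D × Monic (D ∸ m) F
    F-quotient = monic-quotient F (monic-xPowMinusOne m′) (monic-resp-≈ Ψ≈FG Ψ-monic)
    m≤D : m ≤ D
    m≤D = proj₁ F-quotient
    open Monic (proj₂ F-quotient) renaming (leading to F-top; bounded to F-bounded)
    Psi≈ : Psi n ≈ (x^ m ⊗ F) ⊕ neg F
    Psi≈ = ≈-trans (Psi≈Ψ n) (≈-trans Ψ≈FG (≈-trans (⊗-congʳ F (xPowMinusOne≈ m)) (expand F (x^ m))))
      where
      expand : ∀ F X → (F ⊗ (X ⊕ neg one)) ≈ ((X ⊗ F) ⊕ neg F)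
      expand = solve-∀ ℤ[x]-solver
    coeff-Psi : ∀ i → coeff (Psi n) i ≡ coeff (x^ m ⊗ F) i ℤ.+ ℤ.- coeff F i
    coeff-Psi i = trans (at Psi≈ i) (trans (coeff-⊕ (x^ m ⊗ F) (neg F) i) (cong (ℤ._+_ (coeff (x^ m ⊗ F) i)) (coeff-neg F i)))
    2m∸D≡m∸[D∸m] : 2 * m ∸ D ≡ m ∸ (D ∸ m)
    2m∸D≡m∸[D∸m] = trans (cong₂ _∸_ (cong (_+_ m) (ℕP.+-identityʳ m)) (sym (ℕP.m+[n∸m]≡n m≤D)))
                         (ℕP.[m+n]∸[m+o]≡n∸o m m (D ∸ m))
    gap : m ∸ (D ∸ m) ≤ maxGap (Psi n)
    gap with D ∸ m <? m
    ... | no D∸m≮m = subst (_≤ maxGap (Psi n)) (sym (ℕP.m≤n⇒m∸n≡0 (ℕP.≮⇒≥ D∸m≮m))) z≤n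
    ... | yes D∸m<m = maxGap-≥ (Psi n) D∸m<m m≤D (λ eq → -1≢0 (trans (sym low-term) eq)) (λ eq → 1≢0 (trans (sym top-term) eq)) between
      where
      -1≢0 : ¬ ℤ.- + 1 ≡ + 0
      -1≢0 ()
      low-term : coeff (Psi n) (D ∸ m) ≡ ℤ.- + 1
      low-term = trans (coeff-Psi (D ∸ m)) (cong₂ ℤ._+_ (coeff-x^⊗-below m F (D ∸ m) D∸m<m) (cong ℤ.-_ F-top))
      top-term : coeff (Psi n) D ≡ + 1
      top-term = trans (at (Psi≈Ψ n) D) (Monic.leading Ψ-monic)
      between : ∀ i → D ∸ m < i → i < m → coeff (Psi n) i ≡ + 0
      between i D∸m<i i<m = trans (coeff-Psi i) (cong₂ ℤ._+_ (coeff-x^⊗-below m F i i<m) (cong ℤ.-_ (F-bounded i D∸m<i)))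

  ⊖≤∸ : ∀ a b → a ℤ.⊖ b ℤ.≤ + (a ∸ b)
  ⊖≤∸ a b with ℕP.≤-total b a
  ... | inj₁ b≤a = ℤP.≤-reflexive (ℤP.⊖-≥ b≤a)
  ... | inj₂ a≤b = subst (ℤ._≤ + (a ∸ b)) (sym (ℤP.⊖-≤ a≤b)) ℤP.neg-≤-pos

  deltaMinus-≤-maxGap : ∀ p m .{{_ : NonZero p}} → 2 ≤ p → deltaMinus (p * m) p ℤ.≤ + maxGap (Psi (p * m))
  deltaMinus-≤-maxGap p zero _ rewrite ℕP.*-zeroʳ p =
    subst (λ k → + (2 * k) ℤ.- + psi 0 ℤ.≤ + maxGap (Psi 0)) (sym (0/n≡0 p)) (ℤ.+≤+ z≤n)
  deltaMinus-≤-maxGap p m@(suc _) 2≤p = begin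
    + (2 * (p * m / p)) ℤ.- + psi (p * m)   ≡⟨ cong (λ k → + (2 * k) ℤ.- + psi (p * m)) m/p≡m ⟩
    + (2 * m) ℤ.- + psi (p * m)             ≡⟨ ℤP.[+m]-[+n]≡m⊖n (2 * m) (psi (p * m)) ⟩
    (2 * m) ℤ.⊖ psi (p * m)                 ≤⟨ ⊖≤∸ (2 * m) (psi (p * m)) ⟩
    + (2 * m ∸ psi (p * m))                 ≤⟨ ℤ.+≤+ (maxGap-Psi (p * m) m (divides p refl) m<pm) ⟩
    + maxGap (Psi (p * m))                  ∎
    where
    open ℤP.≤-Reasoning
    m/p≡m : p * m / p ≡ m
    m/p≡m = trans (cong (_/ p) (ℕP.*-comm p m)) (m*n/n≡m m p)
    m<pm : m < p * m
    m<pm = subst (m <_) (ℕP.*-comm m p) (ℕP.m<m*n m p 2≤p)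

open import Defs
open import Data.Nat using (ℕ; _<_; NonZero; nonTrivial⇒n>1)
open import Data.Nat.Primality using (Prime; prime⇒nonTrivial)
open import Data.Nat.Divisibility using (_∣_)
open import Data.List using (List; _∷_)
open import Data.Nat.ListAction using (product)
open import Data.List.Relation.Unary.All using (All; _∷_)
open import Data.List.Relation.Unary.Linked using (Linked)
open import Data.Integer using (+_; _≤_)
open import Relation.Nullary using (¬_)

theorem4 : (p₁ : ℕ) (ps : List ℕ) .{{_ : NonZero p₁}} →
    Linked _<_ (p₁ ∷ ps) →
    All Prime (p₁ ∷ ps) →
    All (λ p → ¬ (2 ∣ p)) (p₁ ∷ ps) →
    deltaMinus (product (p₁ ∷ ps)) p₁ ≤ + maxGap (Psi (product (p₁ ∷ ps)))
theorem4 p₁ ps _ (p₁-prime ∷ _) _ =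
  InverseCyclotomic.deltaMinus-≤-maxGap p₁ (product ps) (nonTrivial⇒n>1 p₁ {{prime⇒nonTrivial p₁-prime}})
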